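{- Fix $n\ge1$ and let $M^{(n)}$ be the matrix indexed by pairs of unlabeled binary trees with $n$ nodes with entries $c_{T,U}=\mathrm{Card}\{\sigma\in S_n:\ \mathrm{shape}(\mathrm{bst}(\sigma))=T,\ \mathrm{shape}(\mathrm{bst}(\sigma^{ -1}))=U\}$. Say that $T$ and $U$ are in the same block if some power of $M^{(n)}$ has a nonzero $(T,U)$ entry. Then two trees are in the same block if and only if they have the same size and the same skeleton.
   Context: A binary tree is empty or a node with left and right subtrees. For a word $w$, $\mathrm{bst}(w)$ is obtained by reading $w$ right to left and inserting each letter $x$: into an empty tree create a node labeled $x$; otherwise insert recursively into the left subtree if $x\le$ root label, into the right subtree if $x>$ root label; shape denotes the underlying unlabeled tree. For an unlabeled tree $T$ with $n$ nodes, $w_T\in S_n$ is the right-to-left postfix reading (right subtree, left subtree, root, recursively) of the unique labeling of $T$ by $1,\dots,n$ with each label greater than those of its left subtree and smaller than those of its right subtree. The saillances of a word $\tau$ of distinct integers are the letters $i$ of $\tau$ such that all letters to the right of $i$ in $\tau$ are smaller than $i$. The skeleton of a tree $T$ with $n$ nodes is the pair $(k,l)$ where $k\le n-1$ is the greatest integer such that $w_T(n)=n,\ w_T(n-1)=n-1,\dots,w_T(n-k+1)=n-k+1$, and $l$ is the number of saillances of the word obtained from $w_T$ by removing its last $k$ letters. -}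

module Defs where

open import Data.Nat using (ℕ; zero; suc; _+_; _*_; _∸_; _<ᵇ_; _≡ᵇ_; _⊓_)
open import Data.Bool using (Bool; true; false; if_then_else_; _∧_; not)
open import Data.List using (List; []; _∷_; _++_; map; concatMap; upTo; filterᵇ; length; foldr; reverse; take)
open import Data.Product using (_×_; _,_; ∃-syntax)
open import Data.Bool.ListAction using (all)
open import Data.Nat.ListAction using (sum)
open import Relation.Binary.PropositionalEquality using (_≡_)
open import Relation.Nullary using (¬_)

data BT : Set where
  leaf : BT
  node : BT → BT → BT

size : BT → ℕ
size leaf = 0
size (node l r) = suc (size l + size r)

_==BT_ : BT → BT → Bool
leaf ==BT leaf = true
node l r ==BT node l' r' = (l ==BT l') ∧ (r ==BT r')
_ ==BT _ = false

data LT : Set where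
  lleaf : LT
  lnode : LT → ℕ → LT → LT

shape : LT → BT
shape lleaf = leaf
shape (lnode l _ r) = node (shape l) (shape r)

insert : ℕ → LT → LT
insert x lleaf = lnode lleaf x lleaf
insert x (lnode l y r) = if y <ᵇ x then lnode l y (insert x r) else lnode (insert x l) y r

bst : List ℕ → LT
bst w = foldr insert lleaf w

-- Permutations of S_n as words over {0,…,n-1} (letters shifted by -1;
-- this does not affect shapes of bst trees).
words : ℕ → ℕ → List (List ℕ)
words n zero = [] ∷ []
words n (suc k) = concatMap (λ x → map (x ∷_) (words n k)) (upTo n)

distinct : List ℕ → Bool
distinct [] = true
distinct (x ∷ xs) = all (λ y → not (x ≡ᵇ y)) xs ∧ distinct xs

Sn : ℕ → List (List ℕ)
Sn n = filterᵇ distinct (words n n)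

index : ℕ → List ℕ → ℕ
index j [] = 0
index j (x ∷ xs) = if j ≡ᵇ x then 0 else suc (index j xs)

inverse : List ℕ → List ℕ
inverse σ = map (λ j → index j σ) (upTo (length σ))

treesH : ℕ → List BT
treesH zero = leaf ∷ []
treesH (suc d) = leaf ∷ concatMap (λ l → map (node l) (treesH d)) (treesH d)

-- unlabeled binary trees with n nodes (each has height ≤ n)
trees : ℕ → List BT
trees n = filterᵇ (λ T → size T ≡ᵇ n) (treesH n)

M : ℕ → BT → BT → ℕ
M n T U = length (filterᵇ (λ σ → (shape (bst σ) ==BT T) ∧ (shape (bst (inverse σ)) ==BT U)) (Sn n))

Mpow : ℕ → ℕ → BT → BT → ℕ
Mpow n zero T U = if T ==BT U then 1 else 0
Mpow n (suc k) T U = sum (map (λ V → Mpow n k T V * M n V U) (trees n))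

SameBlock : ℕ → BT → BT → Set
SameBlock n T U = ∃[ k ] ¬ (Mpow n k T U ≡ 0)

-- w_T: in-order labeling by off+1,…,off+size, read right-to-left postfix
wT' : ℕ → BT → List ℕ
wT' off leaf = []
wT' off (node l r) = wT' (suc (off + size l)) r ++ wT' off l ++ (suc (off + size l) ∷ [])

wT : BT → List ℕ
wT T = wT' 0 T

fixedRun : ℕ → List ℕ → ℕ
fixedRun m [] = 0
fixedRun m (x ∷ xs) = if x ≡ᵇ m then suc (fixedRun (m ∸ 1) xs) else 0

saillances : List ℕ → ℕ
saillances [] = 0
saillances (x ∷ xs) = (if all (λ y → y <ᵇ x) xs then 1 else 0) + saillances xs

skeleton : BT → ℕ × ℕ
skeleton T =
  let n = size T
      k = fixedRun n (reverse (wT T)) ⊓ (n ∸ 1)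
  in k , saillances (take (n ∸ k) (wT T))

-- An entry c_{T,U} is nonzero iff some permutation σ has bst-shape T while σ⁻¹
-- has bst-shape U, so the blocks are the connected components of this relation.
--
-- The skeleton is constant on components. If σ ends with its maximum, so does
-- σ⁻¹, and both trees are those of the shorter words under a new root with empty
-- right subtree, which adds 1 to the first component of the skeleton. Otherwise
-- the skeleton of bst(σ) is (0, r) with r the length of its right branch, which
-- is the number of saillances of σ; σ and σ⁻¹ have equally many saillances, as
-- both count the points of the graph of σ with no other point to the north-east.
--
-- Conversely, trees with the same size and skeleton are connected, by induction
-- on the size. Appending the maximum to σ and σ⁻¹ lifts a path to trees under a
-- new root, prepending the minimum lifts it to trees with a new leftmost node.
-- Right combs are alone in their blocks, and every other tree with nonempty
-- right subtree is connected to a tree of the second kind: if σ starts with an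
-- ascent then 0 precedes 1 in σ⁻¹, so in bst(σ⁻¹) the leftmost node 0 hangs
-- below 1 without a right child. The canonical word of T starts with an ascent
-- when both subtrees of T are nonempty; otherwise that of its neighbour does.
module Submission where

open import Defs

open import Data.Bool using (Bool; true; false; T; not; if_then_else_; _∧_)
open import Data.Bool.ListAction using (all)
open import Data.Bool.Properties using (T-≡; T-∧; ∧-zeroʳ; T?)
open import Data.Empty using (⊥)
open import Data.List
  using (List; []; _∷_; _++_; _∷ʳ_; map; foldr; length; applyUpTo; upTo; filter; reverse; take; drop; initLast; _∷ʳ′_)
open import Data.List.Properties
  using ( length-map; length-++; length-applyUpTo; length-filter; map-applyUpTo; map-upTo; applyUpTo-∷ʳ; ++-assoc
        ; ++-identityʳ; reverse-++; take-all; foldr-++; filter-all; filter-none; filter-some; filter-accept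
        ; filter-reject; filter-++)
open import Data.List.Membership.Propositional using (_∈_; _∉_; lose; find)
open import Data.List.Membership.Propositional.Properties
  using ( ∈-++⁻; ∈-++⁺ˡ; ∈-++⁺ʳ; ∈-map⁺; ∈-map⁻; ∈-upTo⁺; ∈-upTo⁻; ∈-filter⁺; ∈-filter⁻; ∈-concatMap⁺
        ; ∈-concatMap⁻; ∈-∃++)
open import Data.List.Membership.Propositional.Properties.WithK using (unique∧set⇒bag)
open import Data.List.Relation.Binary.BagAndSetEquality using (∼bag⇒↭)
open import Data.List.Relation.Binary.Disjoint.Propositional using (Disjoint)
open import Data.List.Relation.Binary.Permutation.Propositional using (_↭_)
open import Data.List.Relation.Binary.Permutation.Propositional.Properties using () renaming (map⁺ to ↭-map⁺)
open import Data.List.Relation.Unary.All as All using (All; []; _∷_)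
open import Data.List.Relation.Unary.All.Properties
  using (¬Any⇒All¬; all⁺; all⁻; applyUpTo⁺₁) renaming (map⁺ to All-map⁺; ++⁺ to All-++⁺; ++⁻ˡ to All-++⁻ˡ)
open import Data.List.Relation.Unary.AllPairs using ([]; _∷_)
open import Data.List.Relation.Unary.Any using (here; there)
open import Data.List.Relation.Unary.Unique.Propositional using (Unique)
import Data.List.Relation.Unary.Unique.Propositional.Properties as Unique
open import Data.Nat
  using ( ℕ; zero; suc; pred; _+_; _*_; _∸_; _⊔_; _⊓_; _≤_; _<_; _≥_; _<?_; _≡ᵇ_; _<ᵇ_; z≤n; s≤s; s≤s⁻¹
        ; z<s; s<s)
open import Data.Nat.Induction using (<-wellFounded)
open import Data.Nat.ListAction using (sum)
open import Data.Nat.ListAction.Properties using (sum-↭)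
open import Data.Nat.Properties
open import Data.List.Membership.DecPropositional _≟_ using (_∈?_)
open import Data.Product using (_×_; _,_; ∃-syntax; proj₁; proj₂; map₁; map₂)
open import Data.Sum using (_⊎_; inj₁; inj₂; [_,_])
open import Function using (_∘_; id)
open import Function.Bundles using (Equivalence; _⇔_; mk⇔)
open import Induction.WellFounded using (Acc; acc)
open import Relation.Binary.Construct.Closure.ReflexiveTransitive as Star using (Star; ε; _◅_; _◅◅_)
open import Relation.Binary.Core using (_Preserves_⟶_)
open import Relation.Binary.Definitions using (tri<; tri≈; tri>)
open import Relation.Binary.PropositionalEquality hiding ([_])
open import Relation.Nullary using (¬_; contradiction; yes; no; ¬?)
open import Relation.Nullary.Reflects using (Reflects; ofʸ; ofⁿ; fromEquivalence)
open import Relation.Unary using (Decidable)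

≡ᵇ-reflects-≡ : ∀ m n → Reflects (m ≡ n) (m ≡ᵇ n)
≡ᵇ-reflects-≡ m n = fromEquivalence (≡ᵇ⇒≡ m n) (≡⇒≡ᵇ m n)

T-injective : ∀ {a b} → (T a → T b) → (T b → T a) → a ≡ b
T-injective {false} {false} _     _     = refl
T-injective {false} {true}  _     Tb→Ta = contradiction (Tb→Ta _) id
T-injective {true}  {false} Ta→Tb _     = contradiction (Ta→Tb _) id
T-injective {true}  {true}  _     _     = refl

T-not-≡ᵇ⇔≢ : ∀ x y → T (not (x ≡ᵇ y)) ⇔ x ≢ y
T-not-≡ᵇ⇔≢ x y with x ≡ᵇ y | ≡ᵇ-reflects-≡ x y
... | true  | ofʸ x≡y = mk⇔ (λ ()) (λ x≢y → x≢y x≡y)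
... | false | ofⁿ x≢y = mk⇔ (λ _ → x≢y) (λ _ → _)

all-++-T : ∀ {A : Set} (p : A → Bool) xs {ys} → T (all p ys) → all p (xs ++ ys) ≡ all p xs
all-++-T p []       all-ys = T-≡ .Equivalence.to all-ys
all-++-T p (x ∷ xs) all-ys = cong (p x ∧_) (all-++-T p xs all-ys)

all-∷ʳ-false : ∀ {A : Set} (p : A → Bool) xs {y} → p y ≡ false → all p (xs ∷ʳ y) ≡ false
all-∷ʳ-false p []       py≡false = cong (_∧ true) py≡false
all-∷ʳ-false p (x ∷ xs) py≡false = trans (cong (p x ∧_) (all-∷ʳ-false p xs py≡false)) (∧-zeroʳ (p x))

length-∷ʳ : ∀ {A : Set} (xs : List A) x → length (xs ∷ʳ x) ≡ suc (length xs)
length-∷ʳ xs x = trans (length-++ xs) (+-comm (length xs) 1)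

take-++ˡ : ∀ {A : Set} {n} (xs ys : List A) → n ≤ length xs → take n (xs ++ ys) ≡ take n xs
take-++ˡ {n = zero}  xs       ys _   = refl
take-++ˡ {n = suc n} (x ∷ xs) ys n≤ = cong (x ∷_) (take-++ˡ xs ys (s≤s⁻¹ n≤))

∈⇒0<length : ∀ {A : Set} {x : A} {xs} → x ∈ xs → 0 < length xs
∈⇒0<length (here _)  = z<s
∈⇒0<length (there _) = z<s

length≢0⇒∈ : ∀ {A : Set} (xs : List A) → length xs ≢ 0 → ∃[ x ] x ∈ xs
length≢0⇒∈ []      len≢0 = contradiction refl len≢0
length≢0⇒∈ (x ∷ _) _     = x , here refl

last-view : ∀ {A : Set} {m} (w : List A) → length w ≡ suc m → ∃[ u ] ∃[ r ] (w ≡ u ∷ʳ r × length u ≡ m)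
last-view w len≡ with initLast w
... | []      = contradiction len≡ λ ()
... | u ∷ʳ′ r = u , r , refl , suc-injective (trans (sym (length-∷ʳ u r)) len≡)

unique-∷ʳ⁻ : ∀ {A : Set} (xs : List A) {x} → Unique (xs ∷ʳ x) → Unique xs × x ∉ xs
unique-∷ʳ⁻ []       _            = [] , λ ()
unique-∷ʳ⁻ (y ∷ xs) (y∉ ∷ uniq) with unique-∷ʳ⁻ xs uniq
... | uniq′ , x∉xs = All-++⁻ˡ xs y∉ ∷ uniq′ , λ
  { (here x≡y)   → All.lookup y∉ (∈-++⁺ʳ xs (here refl)) (sym x≡y)
  ; (there x∈xs) → x∉xs x∈xs
  }

unique-middle : ∀ {A : Set} (xs : List A) {x ys} → Unique (xs ++ x ∷ ys) → x ∉ xs × x ∉ ys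
unique-middle []       uniq = (λ ()) , Unique.Unique[x∷xs]⇒x∉xs uniq
unique-middle (y ∷ xs) (y∉ ∷ uniq) =
  (λ { (here refl)  → All.lookup y∉ (∈-++⁺ʳ xs (here refl)) refl
     ; (there x∈xs) → proj₁ (unique-middle xs uniq) x∈xs
     })
  , proj₂ (unique-middle xs uniq)

sum-map≢0⇒ : ∀ {A : Set} (f : A → ℕ) xs → sum (map f xs) ≢ 0 → ∃[ x ] (x ∈ xs × f x ≢ 0)
sum-map≢0⇒ f []       sum≢0 = contradiction refl sum≢0
sum-map≢0⇒ f (x ∷ xs) sum≢0 with f x ≟ 0
... | no  fx≢0 = x , here refl , fx≢0
... | yes fx≡0 = let y , y∈ , fy≢0 = sum-map≢0⇒ f xs (sum≢0 ∘ cong₂ _+_ fx≡0) in y , there y∈ , fy≢0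

sum-map≢0⇐ : ∀ {A : Set} (f : A → ℕ) {xs x} → x ∈ xs → f x ≢ 0 → sum (map f xs) ≢ 0
sum-map≢0⇐ f {y ∷ _} (here refl) fx≢0 = fx≢0 ∘ m+n≡0⇒m≡0 (f y)
sum-map≢0⇐ f {y ∷ _} (there x∈)  fx≢0 = sum-map≢0⇐ f x∈ fx≢0 ∘ m+n≡0⇒n≡0 (f y)

*≢0⇔ : ∀ m n → m * n ≢ 0 ⇔ (m ≢ 0 × n ≢ 0)
*≢0⇔ m n = mk⇔
  (λ mn≢0 → (λ { refl → mn≢0 refl }) , (λ { refl → mn≢0 (*-zeroʳ m) }))
  (λ (m≢0 , n≢0) mn≡0 → [ m≢0 , n≢0 ] (m*n≡0⇒m≡0∨n≡0 m mn≡0))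

applyUpTo-cong : ∀ {A : Set} {f g : ℕ → A} n → (∀ {i} → i < n → f i ≡ g i) → applyUpTo f n ≡ applyUpTo g n
applyUpTo-cong zero    f≗g = refl
applyUpTo-cong (suc n) f≗g = cong₂ _∷_ (f≗g z<s) (applyUpTo-cong n (f≗g ∘ s<s))

-- Junk value 0 past the end of the list.
nth : List ℕ → ℕ → ℕ
nth []       _       = 0
nth (x ∷ xs) zero    = x
nth (x ∷ xs) (suc i) = nth xs i

nth-∈ : ∀ xs {i} → i < length xs → nth xs i ∈ xs
nth-∈ (x ∷ xs) {zero}  _   = here refl
nth-∈ (x ∷ xs) {suc i} i<n = there (nth-∈ xs (s≤s⁻¹ i<n))

nth-last : ∀ {m} u r → length u ≡ m → nth (u ∷ʳ r) m ≡ r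
nth-last []      r refl = refl
nth-last (_ ∷ u) r refl = nth-last u r refl

applyUpTo-nth : ∀ xs → applyUpTo (nth xs) (length xs) ≡ xs
applyUpTo-nth []       = refl
applyUpTo-nth (x ∷ xs) = cong (x ∷_) (applyUpTo-nth xs)

nth-applyUpTo : ∀ (f : ℕ → ℕ) {n i} → i < n → nth (applyUpTo f n) i ≡ f i
nth-applyUpTo f {suc n} {zero}  _   = refl
nth-applyUpTo f {suc n} {suc i} i<n = nth-applyUpTo (f ∘ suc) (s≤s⁻¹ i<n)

index-head : ∀ x xs → index x (x ∷ xs) ≡ 0
index-head x xs with x ≡ᵇ x | ≡ᵇ-reflects-≡ x x
... | true  | _       = refl
... | false | ofⁿ x≢x = contradiction refl x≢x

index-tail : ∀ {j x} xs → j ≢ x → index j (x ∷ xs) ≡ suc (index j xs)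
index-tail {j} {x} xs j≢x with j ≡ᵇ x | ≡ᵇ-reflects-≡ j x
... | true  | ofʸ j≡x = contradiction j≡x j≢x
... | false | _       = refl

index-< : ∀ {j} xs → j ∈ xs → index j xs < length xs
index-< (x ∷ xs) (here refl) rewrite index-head x xs = z<s
index-< {j} (x ∷ xs) (there j∈xs) with j ≡ᵇ x
... | true  = z<s
... | false = s<s (index-< xs j∈xs)

nth-index : ∀ {j} xs → j ∈ xs → nth xs (index j xs) ≡ j
nth-index (x ∷ xs) (here refl) rewrite index-head x xs = refl
nth-index {j} (x ∷ xs) (there j∈xs) with j ≡ᵇ x | ≡ᵇ-reflects-≡ j x
... | true  | ofʸ j≡x = sym j≡x
... | false | _       = nth-index xs j∈xs

index-nth : ∀ {xs i} → Unique xs → i < length xs → index (nth xs i) xs ≡ i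
index-nth {x ∷ xs} {zero}  _           _   = index-head x xs
index-nth {x ∷ xs} {suc i} (x∉ ∷ uniq) i<n =
  trans (index-tail xs (λ eq → All.lookup x∉ (nth-∈ xs (s≤s⁻¹ i<n)) (sym eq)))
        (cong suc (index-nth uniq (s≤s⁻¹ i<n)))

index-++ˡ : ∀ {j} xs ys → j ∈ xs → index j (xs ++ ys) ≡ index j xs
index-++ˡ (x ∷ xs) ys (here refl) = trans (index-head x (xs ++ ys)) (sym (index-head x xs))
index-++ˡ {j} (x ∷ xs) ys (there j∈xs) with j ≡ᵇ x
... | true  = refl
... | false = cong suc (index-++ˡ xs ys j∈xs)

index-++ʳ : ∀ {j} xs ys → j ∉ xs → index j (xs ++ ys) ≡ length xs + index j ys
index-++ʳ []       ys j∉xs = refl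
index-++ʳ (x ∷ xs) ys j∉xs =
  trans (index-tail (xs ++ ys) (j∉xs ∘ here)) (cong suc (index-++ʳ xs ys (j∉xs ∘ there)))

index-map-suc : ∀ j xs → index (suc j) (map suc xs) ≡ index j xs
index-map-suc j []       = refl
index-map-suc j (x ∷ xs) with j ≡ᵇ x
... | true  = refl
... | false = cong suc (index-map-suc j xs)

0∉map-suc : ∀ xs → 0 ∉ map suc xs
0∉map-suc xs 0∈ with ∈-map⁻ suc 0∈
... | _ , _ , ()

squeeze : ℕ → ℕ → ℕ
squeeze c y = if c <ᵇ y then pred y else y

squeeze-< : ∀ {c} y {m} → y ≢ c → y < suc m → c < suc m → squeeze c y < m
squeeze-< {c} y y≢c y<1+m c<1+m with c <ᵇ y | <ᵇ-reflects-< c y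
squeeze-< (suc y) _ y<1+m _ | true | _ = s≤s⁻¹ y<1+m
... | false | ofⁿ c≮y = <-≤-trans (≤∧≢⇒< (≮⇒≥ c≮y) y≢c) (s≤s⁻¹ c<1+m)

squeeze-injective : ∀ {c} y z → y ≢ c → z ≢ c → squeeze c y ≡ squeeze c z → y ≡ z
squeeze-injective {c} y z y≢c z≢c eq with c <ᵇ y | <ᵇ-reflects-< c y | c <ᵇ z | <ᵇ-reflects-< c z
squeeze-injective zero    _       _   _   _  | true  | ofʸ ()  | _     | _
squeeze-injective _       zero    _   _   _  | _     | _       | true  | ofʸ ()
squeeze-injective (suc y) (suc z) _   _   eq | true  | _       | true  | _       = cong suc eq
squeeze-injective (suc y) z       _   z≢c eq | true  | ofʸ c<y | false | ofⁿ c≮z =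
  contradiction (≤-antisym (≮⇒≥ c≮z) (subst (_ ≤_) eq (s≤s⁻¹ c<y))) z≢c
squeeze-injective y       (suc z) y≢c _   eq | false | ofⁿ c≮y | true  | ofʸ c<z =
  contradiction (≤-antisym (≮⇒≥ c≮y) (subst (_ ≤_) (sym eq) (s≤s⁻¹ c<z))) y≢c
... | false | _ | false | _ = eq

unique-squeeze : ∀ {c xs} → All (_≢ c) xs → Unique xs → Unique (map (squeeze c) xs)
unique-squeeze []            []          = []
unique-squeeze {xs = x ∷ xs} (x≢c ∷ xs≢c) (x∉ ∷ uniq) =
  All-map⁺ (All.zipWith (λ (x≢y , y≢c) eq → x≢y (squeeze-injective x _ x≢c y≢c eq)) (x∉ , xs≢c))
  ∷ unique-squeeze xs≢c uniq

unique-bounded⇒length≤ : ∀ {n} xs → Unique xs → All (_< n) xs → length xs ≤ n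
unique-bounded⇒length≤         []       _           _            = z≤n
unique-bounded⇒length≤ {suc m} (x ∷ xs) (x∉ ∷ uniq) (x<n ∷ xs<n) = s≤s (begin
  length xs                   ≡⟨ length-map (squeeze x) xs ⟨
  length (map (squeeze x) xs) ≤⟨ unique-bounded⇒length≤ _ (unique-squeeze xs≢x uniq) squeezed< ⟩
  m                           ∎)
  where
  open ≤-Reasoning
  xs≢x = All.map (λ x≢y y≡x → x≢y (sym y≡x)) x∉
  squeezed< = All-map⁺ (All.zipWith (λ (y≢x , y<n) → squeeze-< _ y≢x y<n x<n) (xs≢x , xs<n))

record IsPermutation (n : ℕ) (σ : List ℕ) : Set where
  field
    length≡ : length σ ≡ n
    bounded : All (_< n) σ
    unique  : Unique σ

  ∈⇒< : ∀ {j} → j ∈ σ → j < n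
  ∈⇒< = All.lookup bounded

  <⇒∈ : ∀ {j} → j < n → j ∈ σ
  <⇒∈ {j} j<n with j ∈? σ
  ... | yes j∈σ = j∈σ
  ... | no  j∉σ = contradiction
    (unique-bounded⇒length≤ (j ∷ σ) (¬Any⇒All¬ σ j∉σ ∷ unique) (j<n ∷ bounded))
    (subst (λ k → ¬ suc k ≤ n) (sym length≡) (<-irrefl refl))

isPermutation-↭-upTo : ∀ {n π} → IsPermutation n π → π ↭ upTo n
isPermutation-↭-upTo {n} π-perm =
  ∼bag⇒↭ (unique∧set⇒bag unique (Unique.upTo⁺ n) (mk⇔ (∈-upTo⁺ ∘ ∈⇒<) (<⇒∈ ∘ ∈-upTo⁻)))
  where open IsPermutation π-perm

inverse-applyUpTo : ∀ σ → inverse σ ≡ applyUpTo (λ j → index j σ) (length σ)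
inverse-applyUpTo σ = map-applyUpTo id (λ j → index j σ) (length σ)

length-inverse : ∀ σ → length (inverse σ) ≡ length σ
length-inverse σ = trans (cong length (inverse-applyUpTo σ)) (length-applyUpTo _ (length σ))

nth-inverse : ∀ σ {j} → j < length σ → nth (inverse σ) j ≡ index j σ
nth-inverse σ j<n = trans (cong (λ π → nth π _) (inverse-applyUpTo σ)) (nth-applyUpTo _ j<n)

inverse-prepend-min : ∀ σ → inverse (0 ∷ map suc σ) ≡ 0 ∷ map suc (inverse σ)
inverse-prepend-min σ = begin
  inverse (0 ∷ map suc σ)
    ≡⟨ inverse-applyUpTo (0 ∷ map suc σ) ⟩
  0 ∷ applyUpTo (λ j → suc (index (suc j) (map suc σ))) (length (map suc σ))
    ≡⟨ cong (λ k → 0 ∷ applyUpTo (λ j → suc (index (suc j) (map suc σ))) k) (length-map suc σ) ⟩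
  0 ∷ applyUpTo (λ j → suc (index (suc j) (map suc σ))) (length σ)
    ≡⟨ cong (0 ∷_) (applyUpTo-cong (length σ) λ {j} _ → cong suc (index-map-suc j σ)) ⟩
  0 ∷ applyUpTo (λ j → suc (index j σ)) (length σ)
    ≡⟨ cong (0 ∷_) (map-applyUpTo _ suc (length σ)) ⟨
  0 ∷ map suc (applyUpTo (λ j → index j σ) (length σ))
    ≡⟨ cong (λ π → 0 ∷ map suc π) (inverse-applyUpTo σ) ⟨
  0 ∷ map suc (inverse σ) ∎
  where open ≡-Reasoning

module _ {n σ} (σ-perm : IsPermutation n σ) where
  open IsPermutation σ-perm

  inverse-isPermutation : IsPermutation n (inverse σ)
  inverse-isPermutation = record
    { length≡ = trans (length-inverse σ) length≡
    ; bounded = subst (All (_< n)) (sym (inverse-applyUpTo σ)) (applyUpTo⁺₁ _ (length σ) index<n)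
    ; unique  = subst Unique (sym (inverse-applyUpTo σ))
                  (Unique.applyUpTo⁺₁ _ (length σ) λ i<j j<n eq → <⇒≢ i<j (index-injective (<-trans i<j j<n) j<n eq))
    }
    where
    <n : ∀ {j} → j < length σ → j < n
    <n = subst (_ <_) length≡
    index<n : ∀ {j} → j < length σ → index j σ < n
    index<n j<len = <n (index-< σ (<⇒∈ (<n j<len)))
    index-injective : ∀ {i j} → i < length σ → j < length σ → index i σ ≡ index j σ → i ≡ j
    index-injective i<len j<len eq =
      trans (sym (nth-index σ (<⇒∈ (<n i<len)))) (trans (cong (nth σ) eq) (nth-index σ (<⇒∈ (<n j<len))))

  index-inverse : ∀ {i} → i < n → index i (inverse σ) ≡ nth σ i
  index-inverse {i} i<n = begin
    index i (inverse σ)                           ≡⟨ cong (λ j → index j (inverse σ)) nth-inverse-nth ⟨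
    index (nth (inverse σ) (nth σ i)) (inverse σ) ≡⟨ index-nth (IsPermutation.unique inverse-isPermutation) σi<len′ ⟩
    nth σ i                                       ∎
    where
    open ≡-Reasoning
    i<len = subst (i <_) (sym length≡) i<n
    σi<len = subst (nth σ i <_) (sym length≡) (∈⇒< (nth-∈ σ i<len))
    σi<len′ = subst (nth σ i <_) (sym (length-inverse σ)) σi<len
    nth-inverse-nth : nth (inverse σ) (nth σ i) ≡ i
    nth-inverse-nth = trans (nth-inverse σ σi<len) (index-nth unique i<len)

  inverse-involutive : inverse (inverse σ) ≡ σ
  inverse-involutive = begin
    inverse (inverse σ)                                        ≡⟨ inverse-applyUpTo (inverse σ) ⟩
    applyUpTo (λ i → index i (inverse σ)) (length (inverse σ)) ≡⟨ cong (applyUpTo _) (length-inverse σ) ⟩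
    applyUpTo (λ i → index i (inverse σ)) (length σ)           ≡⟨ applyUpTo-cong (length σ) (index-inverse ∘ <n) ⟩
    applyUpTo (nth σ) (length σ)                               ≡⟨ applyUpTo-nth σ ⟩
    σ                                                          ∎
    where
    open ≡-Reasoning
    <n : ∀ {i} → i < length σ → i < n
    <n = subst (_ <_) length≡

  ∷ʳ-max-isPermutation : IsPermutation (suc n) (σ ∷ʳ n)
  ∷ʳ-max-isPermutation = record
    { length≡ = trans (length-∷ʳ σ n) (cong suc length≡)
    ; bounded = All-++⁺ (All.map m<n⇒m<1+n bounded) (≤-refl ∷ [])
    ; unique  = Unique.++⁺ unique ([] ∷ []) (λ { (n∈σ , here refl) → <-irrefl refl (∈⇒< n∈σ) })
    }

  prepend-min-isPermutation : IsPermutation (suc n) (0 ∷ map suc σ)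
  prepend-min-isPermutation = record
    { length≡ = cong suc (trans (length-map suc σ) length≡)
    ; bounded = z<s ∷ All-map⁺ (All.map s<s bounded)
    ; unique  = ¬Any⇒All¬ _ (0∉map-suc σ) ∷ Unique.map⁺ suc-injective unique
    }

  inverse-∷ʳ-max : inverse (σ ∷ʳ n) ≡ inverse σ ∷ʳ n
  inverse-∷ʳ-max = begin
    inverse (σ ∷ʳ n)
      ≡⟨ inverse-applyUpTo (σ ∷ʳ n) ⟩
    applyUpTo (λ j → index j (σ ∷ʳ n)) (length (σ ∷ʳ n))
      ≡⟨ cong (applyUpTo _) (trans (length-∷ʳ σ n) (cong suc length≡)) ⟩
    applyUpTo (λ j → index j (σ ∷ʳ n)) (suc n)
      ≡⟨ applyUpTo-∷ʳ _ n ⟨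
    applyUpTo (λ j → index j (σ ∷ʳ n)) n ∷ʳ index n (σ ∷ʳ n)
      ≡⟨ cong₂ _∷ʳ_ (applyUpTo-cong n (index-++ˡ σ _ ∘ <⇒∈)) last ⟩
    applyUpTo (λ j → index j σ) n ∷ʳ n
      ≡⟨ cong (λ k → applyUpTo _ k ∷ʳ n) length≡ ⟨
    applyUpTo (λ j → index j σ) (length σ) ∷ʳ n
      ≡⟨ cong (_∷ʳ n) (inverse-applyUpTo σ) ⟨
    inverse σ ∷ʳ n ∎
    where
    open ≡-Reasoning
    last : index n (σ ∷ʳ n) ≡ n
    last = begin
      index n (σ ∷ʳ n)            ≡⟨ index-++ʳ σ _ (λ n∈σ → <-irrefl refl (∈⇒< n∈σ)) ⟩
      length σ + index n (n ∷ []) ≡⟨ cong₂ _+_ length≡ (index-head n []) ⟩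
      n + 0                       ≡⟨ +-identityʳ n ⟩
      n                           ∎

  inverse-rotate : inverse (map suc σ ∷ʳ 0) ≡ n ∷ inverse σ
  inverse-rotate = begin
    inverse (map suc σ ∷ʳ 0)
      ≡⟨ inverse-applyUpTo (map suc σ ∷ʳ 0) ⟩
    applyUpTo (λ j → index j (map suc σ ∷ʳ 0)) (length (map suc σ ∷ʳ 0))
      ≡⟨ cong (applyUpTo _) (trans (length-∷ʳ (map suc σ) 0) (cong suc length-map-suc)) ⟩
    index 0 (map suc σ ∷ʳ 0) ∷ applyUpTo (λ j → index (suc j) (map suc σ ∷ʳ 0)) n
      ≡⟨ cong₂ _∷_ first (applyUpTo-cong n rest) ⟩
    n ∷ applyUpTo (λ j → index j σ) n
      ≡⟨ cong (λ k → n ∷ applyUpTo _ k) length≡ ⟨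
    n ∷ applyUpTo (λ j → index j σ) (length σ)
      ≡⟨ cong (n ∷_) (inverse-applyUpTo σ) ⟨
    n ∷ inverse σ ∎
    where
    open ≡-Reasoning
    length-map-suc : length (map suc σ) ≡ n
    length-map-suc = trans (length-map suc σ) length≡
    first : index 0 (map suc σ ∷ʳ 0) ≡ n
    first = begin
      index 0 (map suc σ ∷ʳ 0)              ≡⟨ index-++ʳ (map suc σ) _ (0∉map-suc σ) ⟩
      length (map suc σ) + index 0 (0 ∷ []) ≡⟨ cong₂ _+_ length-map-suc (index-head 0 []) ⟩
      n + 0                                 ≡⟨ +-identityʳ n ⟩
      n                                     ∎
    rest : ∀ {j} → j < n → index (suc j) (map suc σ ∷ʳ 0) ≡ index j σ
    rest {j} j<n = trans (index-++ˡ (map suc σ) _ (∈-map⁺ suc (<⇒∈ j<n))) (index-map-suc j σ)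

∷ʳ-max-isPermutation⁻ : ∀ {n} σ → IsPermutation (suc n) (σ ∷ʳ n) → IsPermutation n σ
∷ʳ-max-isPermutation⁻ {n} σ σn-perm = record
  { length≡ = suc-injective (trans (sym (length-∷ʳ σ n)) length≡)
  ; bounded = All.tabulate λ j∈σ → ≤∧≢⇒< (s≤s⁻¹ (∈⇒< (∈-++⁺ˡ j∈σ))) λ { refl → n∉σ j∈σ }
  ; unique  = proj₁ (unique-∷ʳ⁻ σ unique)
  }
  where
  open IsPermutation σn-perm
  n∉σ = proj₂ (unique-∷ʳ⁻ σ unique)

relabel : (ℕ → ℕ) → LT → LT
relabel f lleaf         = lleaf
relabel f (lnode l x r) = lnode (relabel f l) (f x) (relabel f r)

shape-relabel : ∀ f t → shape (relabel f t) ≡ shape t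
shape-relabel f lleaf         = refl
shape-relabel f (lnode l x r) = cong₂ node (shape-relabel f l) (shape-relabel f r)

<ᵇ-preserved : ∀ {f} → f Preserves _<_ ⟶ _<_ → ∀ x y → (f x <ᵇ f y) ≡ (x <ᵇ y)
<ᵇ-preserved {f} f-mono x y with f x <ᵇ f y | <ᵇ-reflects-< (f x) (f y) | x <ᵇ y | <ᵇ-reflects-< x y
... | true  | _         | true  | _       = refl
... | false | _         | false | _       = refl
... | false | ofⁿ fx≮fy | true  | ofʸ x<y = contradiction (f-mono x<y) fx≮fy
... | true  | ofʸ fx<fy | false | ofⁿ x≮y with m≤n⇒m<n∨m≡n (≮⇒≥ x≮y)
...   | inj₁ y<x  = contradiction fx<fy (<⇒≯ (f-mono y<x))
...   | inj₂ refl = contradiction fx<fy (<-irrefl refl)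

insert-relabel : ∀ {f} → f Preserves _<_ ⟶ _<_ → ∀ x t → insert (f x) (relabel f t) ≡ relabel f (insert x t)
insert-relabel f-mono x lleaf = refl
insert-relabel {f} f-mono x (lnode l y r) rewrite <ᵇ-preserved f-mono y x with y <ᵇ x
... | true  = cong (lnode (relabel f l) (f y)) (insert-relabel f-mono x r)
... | false = cong (λ t → lnode t (f y) (relabel f r)) (insert-relabel f-mono x l)

shape-bst-map : ∀ {f} → f Preserves _<_ ⟶ _<_ → ∀ w → shape (bst (map f w)) ≡ shape (bst w)
shape-bst-map {f} f-mono w = trans (cong shape (bst-map w)) (shape-relabel f (bst w))
  where
  bst-map : ∀ w → bst (map f w) ≡ relabel f (bst w)
  bst-map []      = refl
  bst-map (x ∷ w) = trans (cong (insert (f x)) (bst-map w)) (insert-relabel f-mono x (bst w))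

size-insert : ∀ x t → size (shape (insert x t)) ≡ suc (size (shape t))
size-insert x lleaf = refl
size-insert x (lnode l y r) with y <ᵇ x
... | true  = trans (cong (λ k → suc (size (shape l) + k)) (size-insert x r)) (cong suc (+-suc _ _))
... | false = cong (λ k → suc (k + size (shape r))) (size-insert x l)

size-bst : ∀ w → size (shape (bst w)) ≡ length w
size-bst []      = refl
size-bst (x ∷ w) = trans (size-insert x (bst w)) (cong suc (size-bst w))

shape-insert : ∀ x t → ∃[ a ] ∃[ b ] shape (insert x t) ≡ node a b
shape-insert x lleaf = leaf , leaf , refl
shape-insert x (lnode l y r) with y <ᵇ x
... | true  = shape l , shape (insert x r) , refl
... | false = shape (insert x l) , shape r , refl

module _ {P : LT → Set} {Q : ℕ → Set} (insert-preserves : ∀ {x t} → Q x → P t → P (insert x t)) where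

  insertAll-preserves : ∀ {xs t} → All Q xs → P t → P (foldr insert t xs)
  insertAll-preserves {[]}         []         Pt = Pt
  insertAll-preserves {x ∷ xs} {t} (qx ∷ Qxs) Pt =
    insert-preserves {x} {foldr insert t xs} qx (insertAll-preserves Qxs Pt)

data AllLabels (P : ℕ → Set) : LT → Set where
  lleaf : AllLabels P lleaf
  lnode : ∀ {l x r} → AllLabels P l → P x → AllLabels P r → AllLabels P (lnode l x r)

module _ {P : ℕ → Set} where

  insert-AllLabels⁺ : ∀ {x} t → P x → AllLabels P t → AllLabels P (insert x t)
  insert-AllLabels⁺ lleaf px lleaf = lnode lleaf px lleaf
  insert-AllLabels⁺ {x} (lnode l y r) px (lnode Pl py Pr) with y <ᵇ x
  ... | true  = lnode Pl py (insert-AllLabels⁺ r px Pr)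
  ... | false = lnode (insert-AllLabels⁺ l px Pl) py Pr

  insert-AllLabels⁻ : ∀ {x} t → AllLabels P (insert x t) → P x × AllLabels P t
  insert-AllLabels⁻ lleaf (lnode _ px _) = px , lleaf
  insert-AllLabels⁻ {x} (lnode l y r) P-ins with y <ᵇ x | P-ins
  ... | true  | lnode Pl py Pr = map₂ (lnode Pl py) (insert-AllLabels⁻ r Pr)
  ... | false | lnode Pl py Pr = map₂ (λ Pl′ → lnode Pl′ py Pr) (insert-AllLabels⁻ l Pl)

  bst-AllLabels⁺ : ∀ {w} → All P w → AllLabels P (bst w)
  bst-AllLabels⁺ []        = lleaf
  bst-AllLabels⁺ (px ∷ Pw) = insert-AllLabels⁺ _ px (bst-AllLabels⁺ Pw)

  bst-AllLabels⁻ : ∀ w → AllLabels P (bst w) → All P w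
  bst-AllLabels⁻ []      _  = []
  bst-AllLabels⁻ (x ∷ w) Pt = let px , Pt′ = insert-AllLabels⁻ (bst w) Pt in px ∷ bst-AllLabels⁻ w Pt′

addLeftmost : BT → BT
addLeftmost leaf       = node leaf leaf
addLeftmost (node l r) = node (addLeftmost l) r

addRightmost : BT → BT
addRightmost leaf       = node leaf leaf
addRightmost (node l r) = node l (addRightmost r)

size-addLeftmost : ∀ t → size (addLeftmost t) ≡ suc (size t)
size-addLeftmost leaf       = refl
size-addLeftmost (node l r) = cong (λ k → suc (k + size r)) (size-addLeftmost l)

insert-min : ∀ {x} t → AllLabels (x ≤_) t → shape (insert x t) ≡ addLeftmost (shape t)
insert-min lleaf _ = refl
insert-min {x} (lnode l y r) (lnode x≤l x≤y _) with y <ᵇ x | <ᵇ-reflects-< y x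
... | true  | ofʸ y<x = contradiction x≤y (<⇒≱ y<x)
... | false | _       = cong (λ t → node t (shape r)) (insert-min l x≤l)

insert-max : ∀ {x} t → AllLabels (_< x) t → shape (insert x t) ≡ addRightmost (shape t)
insert-max lleaf _ = refl
insert-max {x} (lnode l y r) (lnode _ y<x r<x) with y <ᵇ x | <ᵇ-reflects-< y x
... | true  | _       = cong (node (shape l)) (insert-max r r<x)
... | false | ofⁿ y≮x = contradiction y<x y≮x

below above : ℕ → List ℕ → List ℕ
below r = filter (¬? ∘ (r <?_))
above r = filter (r <?_)

bst-∷ʳ : ∀ u r → bst (u ∷ʳ r) ≡ lnode (bst (below r u)) r (bst (above r u))
bst-∷ʳ []      r = refl
bst-∷ʳ (x ∷ u) r rewrite bst-∷ʳ u r with r <ᵇ x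
... | true  = refl
... | false = refl

shape-bst-∷ʳ-max : ∀ {m} u → All (_< m) u → shape (bst (u ∷ʳ m)) ≡ node (shape (bst u)) leaf
shape-bst-∷ʳ-max {m} u u<m rewrite bst-∷ʳ u m
  | filter-all (¬? ∘ (m <?_)) (All.map <⇒≯ u<m) | filter-none (m <?_) (All.map <⇒≯ u<m) = refl

-- Skeletons

rightBranch : BT → ℕ
rightBranch leaf       = 0
rightBranch (node _ r) = suc (rightBranch r)

length-wT' : ∀ off t → length (wT' off t) ≡ size t
length-wT' off leaf       = refl
length-wT' off (node l r) = begin
  length (wT' c r ++ wT' off l ∷ʳ c)         ≡⟨ length-++ (wT' c r) ⟩
  length (wT' c r) + length (wT' off l ∷ʳ c) ≡⟨ cong₂ _+_ (length-wT' c r) (length-∷ʳ (wT' off l) c) ⟩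
  size r + suc (length (wT' off l))          ≡⟨ cong (λ k → size r + suc k) (length-wT' off l) ⟩
  size r + suc (size l)                      ≡⟨ +-suc (size r) (size l) ⟩
  suc (size r + size l)                      ≡⟨ cong suc (+-comm (size r) (size l)) ⟩
  suc (size l + size r)                      ∎
  where
  open ≡-Reasoning
  c = suc (off + size l)

wT'-bounds : ∀ off t → All (λ v → off < v × v ≤ off + size t) (wT' off t)
wT'-bounds off leaf       = []
wT'-bounds off (node l r) =
  All-++⁺ (All.map right (wT'-bounds c r)) (All-++⁺ (All.map left (wT'-bounds off l)) ((off<c , c≤) ∷ []))
  where
  c = suc (off + size l)
  off<c : off < c
  off<c = s≤s (m≤m+n off (size l))
  c+r≡ : c + size r ≡ off + size (node l r)
  c+r≡ = trans (cong suc (+-assoc off (size l) (size r))) (sym (+-suc off _))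
  c≤ : c ≤ off + size (node l r)
  c≤ = subst (c ≤_) c+r≡ (m≤m+n c (size r))
  right : ∀ {v} → c < v × v ≤ c + size r → off < v × v ≤ off + size (node l r)
  right {v} (c<v , v≤) = <-trans off<c c<v , subst (v ≤_) c+r≡ v≤
  left : ∀ {v} → off < v × v ≤ off + size l → off < v × v ≤ off + size (node l r)
  left (off<v , v≤) = off<v , ≤-trans v≤ (≤-trans (n≤1+n _) c≤)

saillances-++ : ∀ xs ys → All (λ x → All (_< x) ys) xs → saillances (xs ++ ys) ≡ saillances xs + saillances ys
saillances-++ []       ys _              = refl
saillances-++ (x ∷ xs) ys (ys<x ∷ ys<xs) = begin
  (if all (_<ᵇ x) (xs ++ ys) then 1 else 0) + saillances (xs ++ ys)
    ≡⟨ cong₂ (λ b s → (if b then 1 else 0) + s) (all-++-T (_<ᵇ x) xs (all⁻ (_<ᵇ x) (All.map <⇒<ᵇ ys<x)))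
             (saillances-++ xs ys ys<xs) ⟩
  (if all (_<ᵇ x) xs then 1 else 0) + (saillances xs + saillances ys)
    ≡⟨ +-assoc _ (saillances xs) (saillances ys) ⟨
  saillances (x ∷ xs) + saillances ys ∎
  where open ≡-Reasoning

all-above : ∀ {r x} → r < x → ∀ u → all (_<ᵇ x) (above r u) ≡ all (_<ᵇ x) u
all-above r<x []      = refl
all-above {r} {x} r<x (y ∷ u) with r <ᵇ y | <ᵇ-reflects-< r y
... | true  | _       = cong ((y <ᵇ x) ∧_) (all-above r<x u)
... | false | ofⁿ r≮y with y <ᵇ x | <ᵇ-reflects-< y x
...   | true  | _       = all-above r<x u
...   | false | ofⁿ y≮x = contradiction (≤-<-trans (≮⇒≥ r≮y) r<x) y≮x

saillances-∷ʳ : ∀ u r → saillances (u ∷ʳ r) ≡ suc (saillances (above r u))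
saillances-∷ʳ []      r = refl
saillances-∷ʳ (x ∷ u) r with r <ᵇ x in r<ᵇx | <ᵇ-reflects-< r x
... | true  | ofʸ r<x = begin
  (if all (_<ᵇ x) (u ∷ʳ r) then 1 else 0) + saillances (u ∷ʳ r)
    ≡⟨ cong₂ (λ b s → (if b then 1 else 0) + s) sameTest (saillances-∷ʳ u r) ⟩
  (if all (_<ᵇ x) (above r u) then 1 else 0) + suc (saillances (above r u))
    ≡⟨ +-suc _ _ ⟩
  suc (saillances (x ∷ above r u)) ∎
  where
  open ≡-Reasoning
  sameTest : all (_<ᵇ x) (u ∷ʳ r) ≡ all (_<ᵇ x) (above r u)
  sameTest = trans (all-++-T (_<ᵇ x) u (all⁻ (_<ᵇ x) (<⇒<ᵇ r<x ∷ []))) (sym (all-above r<x u))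
... | false | _ =
  trans (cong (λ b → (if b then 1 else 0) + saillances (u ∷ʳ r)) (all-∷ʳ-false (_<ᵇ x) u r<ᵇx)) (saillances-∷ʳ u r)

saillances-wT' : ∀ off t → saillances (wT' off t) ≡ rightBranch t
saillances-wT' off leaf       = refl
saillances-wT' off (node l r) = begin
  saillances (wT' c r ++ wT' off l ∷ʳ c)
    ≡⟨ saillances-++ (wT' c r) _ (All.map (λ (c<x , _) → All-++⁺ (All.map (λ v<c → <-trans v<c c<x) l<c) (c<x ∷ []))
                                          (wT'-bounds c r)) ⟩
  saillances (wT' c r) + saillances (wT' off l ∷ʳ c)
    ≡⟨ cong₂ _+_ (saillances-wT' c r) (saillances-∷ʳ (wT' off l) c) ⟩
  rightBranch r + suc (saillances (above c (wT' off l)))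
    ≡⟨ cong (λ xs → rightBranch r + suc (saillances xs)) (filter-none (c <?_) (All.map <⇒≯ l<c)) ⟩
  rightBranch r + 1
    ≡⟨ +-comm (rightBranch r) 1 ⟩
  suc (rightBranch r) ∎
  where
  open ≡-Reasoning
  c = suc (off + size l)
  l<c : All (_< c) (wT' off l)
  l<c = All.map (s≤s ∘ proj₂) (wT'-bounds off l)

rightBranch-bst : ∀ w → rightBranch (shape (bst w)) ≡ saillances w
rightBranch-bst w = go w (<-wellFounded (length w))
  where
  go : ∀ w → Acc _<_ (length w) → rightBranch (shape (bst w)) ≡ saillances w
  go w (acc rec) with initLast w
  ... | []      = refl
  ... | u ∷ʳ′ r = begin
    rightBranch (shape (bst (u ∷ʳ r)))          ≡⟨ cong (rightBranch ∘ shape) (bst-∷ʳ u r) ⟩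
    suc (rightBranch (shape (bst (above r u)))) ≡⟨ cong suc (go (above r u) (rec shorter)) ⟩
    suc (saillances (above r u))                ≡⟨ saillances-∷ʳ u r ⟨
    saillances (u ∷ʳ r)                         ∎
    where
    open ≡-Reasoning
    shorter : length (above r u) < length (u ∷ʳ r)
    shorter = subst (length (above r u) <_) (sym (length-∷ʳ u r)) (s≤s (length-filter (r <?_) u))

fixedRun-≢ : ∀ {m x} xs → x ≢ m → fixedRun m (x ∷ xs) ≡ 0
fixedRun-≢ {m} {x} xs x≢m with x ≡ᵇ m | ≡ᵇ-reflects-≡ x m
... | true  | ofʸ x≡m = contradiction x≡m x≢m
... | false | _       = refl

fixedRun-≡ : ∀ m xs → fixedRun m (m ∷ xs) ≡ suc (fixedRun (m ∸ 1) xs)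
fixedRun-≡ m xs with m ≡ᵇ m | ≡ᵇ-reflects-≡ m m
... | true  | _       = refl
... | false | ofⁿ m≢m = contradiction refl m≢m

fixedRunOf : BT → ℕ
fixedRunOf t = fixedRun (size t) (reverse (wT t))

reverse-wT-node : ∀ l r → reverse (wT (node l r)) ≡ suc (size l) ∷ reverse (wT' (suc (size l)) r ++ wT l)
reverse-wT-node l r = trans (cong reverse (sym (++-assoc (wT' (suc (size l)) r) (wT l) _)))
                            (reverse-++ (wT' (suc (size l)) r ++ wT l) _)

skeleton-node-node : ∀ l a b → skeleton (node l (node a b)) ≡ (0 , rightBranch (node l (node a b)))
skeleton-node-node l a b = cong₂ _,_ k≡0 (begin
  saillances (take (size t ∸ k) (wT t)) ≡⟨ cong (λ j → saillances (take (size t ∸ j) (wT t))) k≡0 ⟩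
  saillances (take (size t) (wT t))     ≡⟨ cong saillances (take-all (size t) (wT t) (≤-reflexive (length-wT' 0 t))) ⟩
  saillances (wT t)                     ≡⟨ saillances-wT' 0 t ⟩
  rightBranch t                         ∎)
  where
  open ≡-Reasoning
  t = node l (node a b)
  k = fixedRunOf t ⊓ (size t ∸ 1)
  k≡0 : k ≡ 0
  k≡0 = cong (_⊓ (size t ∸ 1)) (trans (cong (fixedRun (size t)) (reverse-wT-node l (node a b)))
          (fixedRun-≢ (reverse (wT' (suc (size l)) (node a b) ++ wT l)) (m+1+n≢m (size l) ∘ sym ∘ suc-injective)))

skeleton-rightNonLeaf : ∀ l r → 0 < size r → skeleton (node l r) ≡ (0 , rightBranch (node l r))
skeleton-rightNonLeaf l (node a b) _ = skeleton-node-node l a b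

fixedRunOf-node-leaf : ∀ l → fixedRunOf (node l leaf) ≡ suc (fixedRunOf l)
fixedRunOf-node-leaf l = begin
  fixedRun (suc (size l + 0)) (reverse (wT l ∷ʳ suc (size l)))
    ≡⟨ cong (λ n → fixedRun (suc n) (reverse (wT l ∷ʳ suc (size l)))) (+-identityʳ (size l)) ⟩
  fixedRun (suc (size l)) (reverse (wT l ∷ʳ suc (size l)))
    ≡⟨ cong (fixedRun (suc (size l))) (reverse-++ (wT l) _) ⟩
  fixedRun (suc (size l)) (suc (size l) ∷ reverse (wT l))
    ≡⟨ fixedRun-≡ (suc (size l)) (reverse (wT l)) ⟩
  suc (fixedRunOf l) ∎
  where open ≡-Reasoning

skeleton-node-leaf : ∀ a b → skeleton (node (node a b) leaf) ≡ map₁ suc (skeleton (node a b))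
skeleton-node-leaf a b = cong₂ _,_ k≡ (cong saillances (begin
  take (size t ∸ kt) (wT l ∷ʳ suc (size l))
    ≡⟨ cong (λ j → take j (wT l ∷ʳ suc (size l))) (cong₂ _∸_ (cong suc (+-identityʳ (size l))) k≡) ⟩
  take (size l ∸ kl) (wT l ∷ʳ suc (size l))
    ≡⟨ take-++ˡ (wT l) _ (subst (size l ∸ kl ≤_) (sym (length-wT' 0 l)) (m∸n≤m (size l) kl)) ⟩
  take (size l ∸ kl) (wT l) ∎))
  where
  open ≡-Reasoning
  l  = node a b
  t  = node l leaf
  kl = fixedRunOf l ⊓ (size l ∸ 1)
  kt = fixedRunOf t ⊓ (size t ∸ 1)
  k≡ : kt ≡ suc kl
  k≡ = cong₂ _⊓_ (fixedRunOf-node-leaf l) (+-identityʳ (size l))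

skeleton-node-leaf≢0 : ∀ a b → proj₁ (skeleton (node (node a b) leaf)) ≢ 0
skeleton-node-leaf≢0 a b k≡0 = 1+n≢0 (trans (sym (cong proj₁ (skeleton-node-leaf a b))) k≡0)

skeleton-node-leaf-cong : ∀ {X Y} → size X ≡ size Y → skeleton X ≡ skeleton Y →
                          skeleton (node X leaf) ≡ skeleton (node Y leaf)
skeleton-node-leaf-cong {leaf}     {leaf}     _ _     = refl
skeleton-node-leaf-cong {node a b} {node c d} _ skel≡ =
  trans (skeleton-node-leaf a b) (trans (cong (map₁ suc) skel≡) (sym (skeleton-node-leaf c d)))

skeleton-addLeftmost : ∀ t → 0 < size t → proj₁ (skeleton (addLeftmost t)) ≡ 0 → skeleton (addLeftmost t) ≡ skeleton t
skeleton-addLeftmost (node l (node c d))    _ _   =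
  trans (skeleton-node-node (addLeftmost l) c d) (sym (skeleton-node-node l c d))
skeleton-addLeftmost (node leaf leaf)       _ k≡0 = contradiction k≡0 (skeleton-node-leaf≢0 leaf leaf)
skeleton-addLeftmost (node (node a b) leaf) _ k≡0 = contradiction k≡0 (skeleton-node-leaf≢0 (addLeftmost a) b)

-- Invariance of the skeleton under inversion

isSaillanceAt : List ℕ → ℕ → Bool
isSaillanceAt w i = all (_<ᵇ nth w i) (drop (suc i) w)

SaillanceAt : List ℕ → ℕ → Set
SaillanceAt w i = ∀ {j} → i < j → j < length w → nth w j < nth w i

saillances-applyUpTo : ∀ w → saillances w ≡ sum (applyUpTo (λ i → if isSaillanceAt w i then 1 else 0) (length w))
saillances-applyUpTo []      = refl
saillances-applyUpTo (x ∷ w) = cong ((if all (_<ᵇ x) w then 1 else 0) +_) (saillances-applyUpTo w)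

All-drop⇒nth : ∀ {P : ℕ → Set} k w → All P (drop k w) → ∀ {j} → k ≤ j → j < length w → P (nth w j)
All-drop⇒nth zero    (x ∷ w) (px ∷ _) {zero}  _   _   = px
All-drop⇒nth zero    (x ∷ w) (_ ∷ Pw) {suc j} _   j<n = All-drop⇒nth zero w Pw z≤n (s≤s⁻¹ j<n)
All-drop⇒nth (suc k) (x ∷ w) Pw       {suc j} k≤j j<n = All-drop⇒nth k w Pw (s≤s⁻¹ k≤j) (s≤s⁻¹ j<n)

nth⇒All-drop : ∀ {P : ℕ → Set} k w → (∀ {j} → k ≤ j → j < length w → P (nth w j)) → All P (drop k w)
nth⇒All-drop zero    []      _ = []
nth⇒All-drop zero    (x ∷ w) h = h z≤n z<s ∷ nth⇒All-drop zero w (λ _ j<n → h z≤n (s<s j<n))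
nth⇒All-drop (suc k) []      _ = []
nth⇒All-drop (suc k) (x ∷ w) h = nth⇒All-drop k w (λ k≤j j<n → h (s≤s k≤j) (s<s j<n))

isSaillanceAt⇒SaillanceAt : ∀ w i → T (isSaillanceAt w i) → SaillanceAt w i
isSaillanceAt⇒SaillanceAt w i t =
  All-drop⇒nth (suc i) w (All.map (<ᵇ⇒< _ _) (all⁺ (_<ᵇ nth w i) (drop (suc i) w) t))

SaillanceAt⇒isSaillanceAt : ∀ w i → SaillanceAt w i → T (isSaillanceAt w i)
SaillanceAt⇒isSaillanceAt w i sal = all⁻ (_<ᵇ nth w i) (All.map <⇒<ᵇ (nth⇒All-drop (suc i) w sal))

-- Both sides say that no point of the graph of σ lies north-east of (i , σ i).
SaillanceAt-inverse : ∀ {n σ} → IsPermutation n σ → ∀ {i} → i < n → SaillanceAt σ i → SaillanceAt (inverse σ) (nth σ i)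
SaillanceAt-inverse {n} {σ} σ-perm {i} i<n sal {u} σi<u u<len′ = begin-strict
  nth (inverse σ) u         ≡⟨ nth-inverse σ u<len ⟩
  index u σ                 <⟨ j<i ⟩
  i                         ≡⟨ index-nth unique (subst (i <_) (sym length≡) i<n) ⟨
  index (nth σ i) σ         ≡⟨ nth-inverse σ (<-trans σi<u u<len) ⟨
  nth (inverse σ) (nth σ i) ∎
  where
  open ≤-Reasoning
  open IsPermutation σ-perm
  u<len = subst (u <_) (length-inverse σ) u<len′
  u∈σ = <⇒∈ (subst (u <_) length≡ u<len)
  σj≡u = nth-index σ u∈σ
  j<i : index u σ < i
  j<i with <-cmp (index u σ) i
  ... | tri< j<i _ _ = j<i
  ... | tri≈ _ j≡i _ = contradiction (trans (sym σj≡u) (cong (nth σ) j≡i)) (>⇒≢ σi<u)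
  ... | tri> _ _ i<j = contradiction (subst (_< nth σ i) σj≡u (sal i<j (index-< σ u∈σ))) (<⇒≯ σi<u)

isSaillanceAt-inverse : ∀ {n σ} → IsPermutation n σ → ∀ {v} → v < n →
                        isSaillanceAt (inverse σ) v ≡ isSaillanceAt σ (index v σ)
isSaillanceAt-inverse {n} {σ} σ-perm {v} v<n = T-injective
  (λ t → SaillanceAt⇒isSaillanceAt σ _
           (subst₂ SaillanceAt (inverse-involutive σ-perm) (nth-inverse σ (subst (v <_) (sym length≡) v<n))
             (SaillanceAt-inverse (inverse-isPermutation σ-perm) v<n (isSaillanceAt⇒SaillanceAt (inverse σ) v t))))
  (λ t → SaillanceAt⇒isSaillanceAt (inverse σ) v
           (subst (SaillanceAt (inverse σ)) (nth-index σ v∈σ)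
             (SaillanceAt-inverse σ-perm (subst (index v σ <_) length≡ (index-< σ v∈σ)) (isSaillanceAt⇒SaillanceAt σ _ t))))
  where
  open IsPermutation σ-perm
  v∈σ = <⇒∈ v<n

saillances-inverse : ∀ {n σ} → IsPermutation n σ → saillances (inverse σ) ≡ saillances σ
saillances-inverse {n} {σ} σ-perm = begin
  saillances (inverse σ)
    ≡⟨ saillances-applyUpTo (inverse σ) ⟩
  sum (applyUpTo (λ v → if isSaillanceAt (inverse σ) v then 1 else 0) (length (inverse σ)))
    ≡⟨ cong (λ k → sum (applyUpTo (λ v → if isSaillanceAt (inverse σ) v then 1 else 0) k)) (IsPermutation.length≡ σ⁻¹-perm) ⟩
  sum (applyUpTo (λ v → if isSaillanceAt (inverse σ) v then 1 else 0) n)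
    ≡⟨ cong sum (applyUpTo-cong n (λ v<n → cong (λ b → if b then 1 else 0) (isSaillanceAt-inverse σ-perm v<n))) ⟩
  sum (applyUpTo (λ v → g (index v σ)) n)
    ≡⟨ cong sum (map-applyUpTo _ g n) ⟨
  sum (map g (applyUpTo (λ v → index v σ) n))
    ≡⟨ cong (λ k → sum (map g (applyUpTo _ k))) length≡ ⟨
  sum (map g (applyUpTo (λ v → index v σ) (length σ)))
    ≡⟨ cong (sum ∘ map g) (inverse-applyUpTo σ) ⟨
  sum (map g (inverse σ))
    ≡⟨ sum-↭ (↭-map⁺ g (isPermutation-↭-upTo σ⁻¹-perm)) ⟩
  sum (map g (upTo n))
    ≡⟨ cong sum (map-upTo g n) ⟩
  sum (applyUpTo g n)
    ≡⟨ cong (sum ∘ applyUpTo g) length≡ ⟨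
  sum (applyUpTo g (length σ))
    ≡⟨ saillances-applyUpTo σ ⟨
  saillances σ ∎
  where
  open ≡-Reasoning
  open IsPermutation σ-perm
  σ⁻¹-perm = inverse-isPermutation σ-perm
  g : ℕ → ℕ
  g i = if isSaillanceAt σ i then 1 else 0

skeleton-bst-last≢max : ∀ {m w} → IsPermutation (suc m) w → nth w m ≢ m → skeleton (shape (bst w)) ≡ (0 , saillances w)
skeleton-bst-last≢max {m} {w} w-perm last≢m with last-view w (IsPermutation.length≡ w-perm)
... | u , r , refl , length-u = begin
  skeleton (shape (bst (u ∷ʳ r)))
    ≡⟨ cong (skeleton ∘ shape) (bst-∷ʳ u r) ⟩
  skeleton (node L R)
    ≡⟨ skeleton-rightNonLeaf L R (subst (0 <_) (sym (size-bst (above r u))) (∈⇒0<length m∈above)) ⟩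
  (0 , rightBranch (node L R))
    ≡⟨ cong ((0 ,_) ∘ rightBranch ∘ shape) (bst-∷ʳ u r) ⟨
  (0 , rightBranch (shape (bst (u ∷ʳ r))))
    ≡⟨ cong (0 ,_) (rightBranch-bst (u ∷ʳ r)) ⟩
  (0 , saillances (u ∷ʳ r)) ∎
  where
  open ≡-Reasoning
  open IsPermutation w-perm
  L = shape (bst (below r u))
  R = shape (bst (above r u))
  r≢m : r ≢ m
  r≢m = last≢m ∘ trans (nth-last u r length-u)
  m∈above : m ∈ above r u
  m∈above with ∈-++⁻ u (<⇒∈ (n<1+n m))
  ... | inj₁ m∈u        = ∈-filter⁺ (r <?_) m∈u (≤∧≢⇒< (s≤s⁻¹ (∈⇒< (∈-++⁺ʳ u (here refl)))) r≢m)
  ... | inj₂ (here m≡r) = contradiction (sym m≡r) r≢m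

skeleton-bst-inverse : ∀ {n σ} → IsPermutation n σ → skeleton (shape (bst σ)) ≡ skeleton (shape (bst (inverse σ)))
skeleton-bst-inverse {zero} {[]} _ = refl
skeleton-bst-inverse {suc m} {σ} σ-perm with nth σ m ≟ m
... | no last≢m = begin
  skeleton (shape (bst σ))           ≡⟨ skeleton-bst-last≢max σ-perm last≢m ⟩
  (0 , saillances σ)                 ≡⟨ cong (0 ,_) (saillances-inverse σ-perm) ⟨
  (0 , saillances (inverse σ))       ≡⟨ skeleton-bst-last≢max (inverse-isPermutation σ-perm) inverseLast≢m ⟨
  skeleton (shape (bst (inverse σ))) ∎
  where
  open ≡-Reasoning
  open IsPermutation σ-perm
  inverseLast≢m : nth (inverse σ) m ≢ m
  inverseLast≢m eq = last≢m (begin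
    nth σ m           ≡⟨ cong (nth σ) (trans (sym (nth-inverse σ (subst (m <_) (sym length≡) (n<1+n m)))) eq) ⟨
    nth σ (index m σ) ≡⟨ nth-index σ (<⇒∈ (n<1+n m)) ⟩
    m                 ∎)
... | yes last≡m with last-view σ (IsPermutation.length≡ σ-perm)
...   | u , r , refl , length-u with trans (sym (nth-last u r length-u)) last≡m
...     | refl = begin
  skeleton (shape (bst (u ∷ʳ m)))
    ≡⟨ cong skeleton (shape-bst-∷ʳ-max u (IsPermutation.bounded u-perm)) ⟩
  skeleton (node (shape (bst u)) leaf)
    ≡⟨ skeleton-node-leaf-cong size≡ (skeleton-bst-inverse u-perm) ⟩
  skeleton (node (shape (bst (inverse u))) leaf)
    ≡⟨ cong skeleton (shape-bst-∷ʳ-max (inverse u) (IsPermutation.bounded (inverse-isPermutation u-perm))) ⟨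
  skeleton (shape (bst (inverse u ∷ʳ m)))
    ≡⟨ cong (skeleton ∘ shape ∘ bst) (inverse-∷ʳ-max u-perm) ⟨
  skeleton (shape (bst (inverse (u ∷ʳ m)))) ∎
  where
  open ≡-Reasoning
  u-perm = ∷ʳ-max-isPermutation⁻ u σ-perm
  size≡ : size (shape (bst u)) ≡ size (shape (bst (inverse u)))
  size≡ = trans (size-bst u) (sym (trans (size-bst (inverse u)) (length-inverse u)))

-- Blocks and the edge relation

distinct⇔Unique : ∀ xs → T (distinct xs) ⇔ Unique xs
distinct⇔Unique []       = mk⇔ (λ _ → []) (λ _ → _)
distinct⇔Unique (x ∷ xs) = mk⇔
  (λ t → let head , tail = T-∧ .Equivalence.to t in
         All.map (T-not-≡ᵇ⇔≢ x _ .Equivalence.to) (all⁺ _ xs head) ∷ distinct⇔Unique xs .Equivalence.to tail)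
  (λ { (x∉ ∷ uniq) → T-∧ .Equivalence.from
         (all⁻ _ (All.map (T-not-≡ᵇ⇔≢ x _ .Equivalence.from) x∉) , distinct⇔Unique xs .Equivalence.from uniq) })

∈-words⁻ : ∀ {n} k {σ} → σ ∈ words n k → length σ ≡ k × All (_< n) σ
∈-words⁻     zero    (here refl) = refl , []
∈-words⁻ {n} (suc k) σ∈ with find (∈-concatMap⁻ (λ x → map (x ∷_) (words n k)) {xs = upTo n} σ∈)
... | x , x∈ , σ∈′ with ∈-map⁻ (x ∷_) σ∈′
...   | τ , τ∈ , refl = map₁ (cong suc) (map₂ (∈-upTo⁻ x∈ ∷_) (∈-words⁻ k τ∈))

∈-words⁺ : ∀ {n σ} → All (_< n) σ → σ ∈ words n (length σ)
∈-words⁺             []          = here refl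
∈-words⁺ {n} {_ ∷ σ} (x<n ∷ σ<n) =
  ∈-concatMap⁺ (λ x → map (x ∷_) (words n (length σ))) (lose (∈-upTo⁺ x<n) (∈-map⁺ (_ ∷_) (∈-words⁺ σ<n)))

∈-Sn⇔IsPermutation : ∀ {n σ} → σ ∈ Sn n ⇔ IsPermutation n σ
∈-Sn⇔IsPermutation {n} {σ} = mk⇔
  (λ σ∈ → let σ∈words , dist = ∈-filter⁻ (T? ∘ distinct) σ∈
              len≡ , bounded = ∈-words⁻ n σ∈words
          in record { length≡ = len≡ ; bounded = bounded ; unique = distinct⇔Unique σ .Equivalence.to dist })
  (λ σ-perm → let open IsPermutation σ-perm in
    ∈-filter⁺ (T? ∘ distinct) (subst (λ k → σ ∈ words n k) length≡ (∈-words⁺ bounded))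
              (distinct⇔Unique σ .Equivalence.from unique))

==BT⇔≡ : ∀ S U → T (S ==BT U) ⇔ S ≡ U
==BT⇔≡ leaf       leaf         = mk⇔ (λ _ → refl) (λ _ → _)
==BT⇔≡ leaf       (node _ _)   = mk⇔ (λ ()) (λ ())
==BT⇔≡ (node _ _) leaf         = mk⇔ (λ ()) (λ ())
==BT⇔≡ (node l r) (node l′ r′) = mk⇔
  (λ t → let tl , tr = T-∧ .Equivalence.to t in
         cong₂ node (==BT⇔≡ l l′ .Equivalence.to tl) (==BT⇔≡ r r′ .Equivalence.to tr))
  (λ { refl → T-∧ .Equivalence.from (==BT⇔≡ l l .Equivalence.from refl , ==BT⇔≡ r r .Equivalence.from refl) })

Edge : ℕ → BT → BT → Set
Edge n S U = ∃[ σ ] (IsPermutation n σ × shape (bst σ) ≡ S × shape (bst (inverse σ)) ≡ U)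

edge-sym : ∀ {n S U} → Edge n S U → Edge n U S
edge-sym (σ , σ-perm , refl , refl) =
  inverse σ , inverse-isPermutation σ-perm , refl , cong (shape ∘ bst) (inverse-involutive σ-perm)

edge-size : ∀ {n S U} → Edge n S U → size S ≡ n
edge-size (σ , σ-perm , refl , _) = trans (size-bst σ) (IsPermutation.length≡ σ-perm)

edge-skeleton : ∀ {n S U} → Edge n S U → skeleton S ≡ skeleton U
edge-skeleton (σ , σ-perm , refl , refl) = skeleton-bst-inverse σ-perm

M≢0⇔Edge : ∀ n S U → M n S U ≢ 0 ⇔ Edge n S U
M≢0⇔Edge n S U = mk⇔
  (λ M≢0 → let σ , σ∈ = length≢0⇒∈ _ M≢0
               σ∈Sn , t = ∈-filter⁻ (T? ∘ isEdge) σ∈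
               tS , tU = T-∧ .Equivalence.to t
           in σ , ∈-Sn⇔IsPermutation .Equivalence.to σ∈Sn ,
              ==BT⇔≡ _ S .Equivalence.to tS , ==BT⇔≡ _ U .Equivalence.to tU)
  (λ { (σ , σ-perm , refl , refl) → >⇒≢ (filter-some (T? ∘ isEdge)
         (lose (∈-Sn⇔IsPermutation .Equivalence.from σ-perm)
               (T-∧ .Equivalence.from (==BT⇔≡ S S .Equivalence.from refl , ==BT⇔≡ U U .Equivalence.from refl)))) })
  where
  isEdge : List ℕ → Bool
  isEdge σ = (shape (bst σ) ==BT S) ∧ (shape (bst (inverse σ)) ==BT U)

height : BT → ℕ
height leaf       = 0
height (node l r) = suc (height l ⊔ height r)

height≤size : ∀ t → height t ≤ size t
height≤size leaf       = z≤n
height≤size (node l r) =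
  s≤s (⊔-lub (≤-trans (height≤size l) (m≤m+n _ _)) (≤-trans (height≤size r) (m≤n+m _ _)))

∈-treesH : ∀ {d} t → height t ≤ d → t ∈ treesH d
∈-treesH {zero}  leaf       _     = here refl
∈-treesH {suc d} leaf       _     = here refl
∈-treesH {suc d} (node l r) h≤1+d = there (∈-concatMap⁺ (λ l → map (node l) (treesH d))
  (lose (∈-treesH l (≤-trans (m≤m⊔n _ _) (s≤s⁻¹ h≤1+d)))
        (∈-map⁺ (node l) (∈-treesH r (≤-trans (m≤n⊔m _ _) (s≤s⁻¹ h≤1+d))))))

∈-trees : ∀ {n} t → size t ≡ n → t ∈ trees n
∈-trees t refl =
  ∈-filter⁺ (T? ∘ (λ u → size u ≡ᵇ size t)) (∈-treesH t (height≤size t)) (≡⇒≡ᵇ (size t) (size t) refl)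

Mpow-zero≢0⇒≡ : ∀ n S U → Mpow n 0 S U ≢ 0 → S ≡ U
Mpow-zero≢0⇒≡ n S U h with S ==BT U in eq
... | true  = ==BT⇔≡ S U .Equivalence.to (subst T (sym eq) _)
... | false = contradiction refl h

Mpow-zero-diagonal≢0 : ∀ n S → Mpow n 0 S S ≢ 0
Mpow-zero-diagonal≢0 n S with S ==BT S | ==BT⇔≡ S S .Equivalence.from refl
... | true | _ = λ ()

Mpow≢0⇒star : ∀ n k S U → Mpow n k S U ≢ 0 → Star (Edge n) S U
Mpow≢0⇒star n zero    S U h with refl ← Mpow-zero≢0⇒≡ n S U h = ε
Mpow≢0⇒star n (suc k) S U h =
  let V , _ , prod≢0 = sum-map≢0⇒ (λ V → Mpow n k S V * M n V U) (trees n) h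
      Mpow≢0 , M≢0   = *≢0⇔ _ _ .Equivalence.to prod≢0
  in Mpow≢0⇒star n k S V Mpow≢0 ◅◅ (M≢0⇔Edge n V U .Equivalence.to M≢0 ◅ ε)

star⇒Mpow≢0 : ∀ {n S U} → Star (Edge n) S U → ∃[ k ] Mpow n k S U ≢ 0
star⇒Mpow≢0 {n} {S} = extend {0} (Mpow-zero-diagonal≢0 n S)
  where
  extend : ∀ {k V U} → Mpow n k S V ≢ 0 → Star (Edge n) V U → ∃[ k ] Mpow n k S U ≢ 0
  extend {k} h ε        = k , h
  extend {k} h (e ◅ es) = extend {suc k} (sum-map≢0⇐ (λ V → Mpow n k S V * M n V _) (∈-trees _ (edge-size e))
                                           (*≢0⇔ _ _ .Equivalence.from (h , M≢0⇔Edge n _ _ .Equivalence.from e))) es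

star-skeleton : ∀ {n S U} → Star (Edge n) S U → skeleton S ≡ skeleton U
star-skeleton = Star.fold (λ S U → skeleton S ≡ skeleton U) (λ e eq → trans (edge-skeleton e) eq) refl

star-size : ∀ {n S U} → Star (Edge n) S U → size S ≡ size U
star-size = Star.fold (λ S U → size S ≡ size U) (λ e eq → trans (edge-size e) (trans (sym (edge-size (edge-sym e))) eq)) refl

star-sym : ∀ {n S U} → Star (Edge n) S U → Star (Edge n) U S
star-sym = Star.reverse edge-sym


-- The canonical word

merge : List ℕ → List ℕ → List ℕ
merge []       ys = ys
merge (x ∷ xs) ys = x ∷ ys ++ xs

length-merge : ∀ xs ys → length (merge xs ys) ≡ length xs + length ys
length-merge []       ys = refl
length-merge (x ∷ xs) ys = cong suc (trans (length-++ ys) (+-comm (length ys) (length xs)))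

∈-merge⁻ : ∀ {z} xs ys → z ∈ merge xs ys → z ∈ xs ⊎ z ∈ ys
∈-merge⁻ []       ys z∈         = inj₂ z∈
∈-merge⁻ (x ∷ xs) ys (here z≡x) = inj₁ (here z≡x)
∈-merge⁻ (x ∷ xs) ys (there z∈) = [ inj₂ , inj₁ ∘ there ] (∈-++⁻ ys z∈)

unique-merge : ∀ {xs ys} → Unique xs → Unique ys → Disjoint xs ys → Unique (merge xs ys)
unique-merge []                            uniq-ys _    = uniq-ys
unique-merge {x ∷ xs} {ys} (x∉ ∷ uniq-xs) uniq-ys disj =
  All-++⁺ (All.tabulate λ y∈ys x≡y → disj (here refl , subst (_∈ ys) (sym x≡y) y∈ys)) x∉
  ∷ Unique.++⁺ uniq-ys uniq-xs (λ (z∈ys , z∈xs) → disj (there z∈xs , z∈ys))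

module _ {P : ℕ → Set} (P? : Decidable P) where

  filter-merge-left : ∀ {xs ys} → All P xs → All (¬_ ∘ P) ys → filter P? (merge xs ys) ≡ xs
  filter-merge-left {[]}          _          ¬Pys = filter-none P? ¬Pys
  filter-merge-left {x ∷ xs} {ys} (px ∷ Pxs) ¬Pys = begin
    filter P? (x ∷ ys ++ xs)         ≡⟨ filter-accept P? px ⟩
    x ∷ filter P? (ys ++ xs)         ≡⟨ cong (x ∷_) (filter-++ P? ys xs) ⟩
    x ∷ filter P? ys ++ filter P? xs ≡⟨ cong₂ (λ as bs → x ∷ as ++ bs) (filter-none P? ¬Pys) (filter-all P? Pxs) ⟩
    x ∷ xs                           ∎
    where open ≡-Reasoning

  filter-merge-right : ∀ {xs ys} → All (¬_ ∘ P) xs → All P ys → filter P? (merge xs ys) ≡ ys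
  filter-merge-right {[]}          _            Pys = filter-all P? Pys
  filter-merge-right {x ∷ xs} {ys} (¬px ∷ ¬Pxs) Pys = begin
    filter P? (x ∷ ys ++ xs)     ≡⟨ filter-reject P? ¬px ⟩
    filter P? (ys ++ xs)         ≡⟨ filter-++ P? ys xs ⟩
    filter P? ys ++ filter P? xs ≡⟨ cong₂ _++_ (filter-all P? Pys) (filter-none P? ¬Pxs) ⟩
    ys ++ []                     ≡⟨ ++-identityʳ ys ⟩
    ys                           ∎
    where open ≡-Reasoning

-- Any interleaving of the words of the two subtrees, followed by the root,
-- has shape node A B; merge starts with a letter of each subtree, so the word
-- starts with an ascent as soon as both subtrees are nonempty.
canonicalWord : BT → List ℕ
canonicalWord leaf       = []
canonicalWord (node A B) = merge (canonicalWord A) (map (suc (size A) +_) (canonicalWord B)) ∷ʳ size A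

shift-bounds : ∀ a {b} {ys : List ℕ} → All (_< b) ys → All (λ z → a < z × z < suc (a + b)) (map (suc a +_) ys)
shift-bounds a ys<b = All-map⁺ (All.map (λ {y} y<b → s≤s (m≤m+n a y) , s<s (+-monoʳ-< a y<b)) ys<b)

canonicalWord-isPermutation : ∀ T → IsPermutation (size T) (canonicalWord T)
canonicalWord-isPermutation leaf       = record { length≡ = refl ; bounded = [] ; unique = [] }
canonicalWord-isPermutation (node A B) = record
  { length≡ = begin
      length (merge a b ∷ʳ size A) ≡⟨ length-∷ʳ (merge a b) (size A) ⟩
      suc (length (merge a b))     ≡⟨ cong suc (length-merge a b) ⟩
      suc (length a + length b)    ≡⟨ cong₂ (λ i j → suc (i + j)) A.length≡ length-b ⟩
      suc (size A + size B)        ∎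
  ; bounded = All-++⁺ (All.tabulate (proj₂ ∘ merged)) (root< ∷ [])
  ; unique  = Unique.++⁺ (unique-merge A.unique (Unique.map⁺ (+-cancelˡ-≡ (suc (size A)) _ _) B.unique) a∩b≡∅)
                         ([] ∷ []) (λ { (z∈ , here refl) → proj₁ (merged z∈) refl })
  }
  where
  open ≡-Reasoning
  module A = IsPermutation (canonicalWord-isPermutation A)
  module B = IsPermutation (canonicalWord-isPermutation B)
  a = canonicalWord A
  b = map (suc (size A) +_) (canonicalWord B)
  b-bounds = shift-bounds (size A) B.bounded
  length-b = trans (length-map _ (canonicalWord B)) B.length≡
  root< : size A < suc (size A + size B)
  root< = s≤s (m≤m+n (size A) (size B))
  merged : ∀ {z} → z ∈ merge a b → z ≢ size A × z < suc (size A + size B)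
  merged z∈ with ∈-merge⁻ a b z∈
  ... | inj₁ z∈a = <⇒≢ (A.∈⇒< z∈a) , <-trans (A.∈⇒< z∈a) root<
  ... | inj₂ z∈b = >⇒≢ (proj₁ (All.lookup b-bounds z∈b)) , proj₂ (All.lookup b-bounds z∈b)
  a∩b≡∅ : Disjoint a b
  a∩b≡∅ (z∈a , z∈b) = <-asym (A.∈⇒< z∈a) (proj₁ (All.lookup b-bounds z∈b))

shape-bst-canonicalWord : ∀ T → shape (bst (canonicalWord T)) ≡ T
shape-bst-canonicalWord leaf       = refl
shape-bst-canonicalWord (node A B) = begin
  shape (bst (merge a b ∷ʳ size A))
    ≡⟨ cong shape (bst-∷ʳ (merge a b) (size A)) ⟩
  node (shape (bst (below (size A) (merge a b)))) (shape (bst (above (size A) (merge a b))))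
    ≡⟨ cong₂ (λ l r → node (shape (bst l)) (shape (bst r)))
             (filter-merge-left (¬? ∘ (size A <?_)) (All.map <⇒≯ a<) (All.map (λ (A<z , _) ¬A<z → ¬A<z A<z) b-bounds))
             (filter-merge-right (size A <?_) (All.map <⇒≯ a<) (All.map proj₁ b-bounds)) ⟩
  node (shape (bst a)) (shape (bst b))
    ≡⟨ cong₂ node (shape-bst-canonicalWord A)
                  (trans (shape-bst-map (+-monoʳ-< (suc (size A))) (canonicalWord B)) (shape-bst-canonicalWord B)) ⟩
  node A B ∎
  where
  open ≡-Reasoning
  a = canonicalWord A
  b = map (suc (size A) +_) (canonicalWord B)
  a< = IsPermutation.bounded (canonicalWord-isPermutation A)
  b-bounds = shift-bounds (size A) (IsPermutation.bounded (canonicalWord-isPermutation B))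

dual : BT → BT
dual T = shape (bst (inverse (canonicalWord T)))

edge-dual : ∀ T → Edge (size T) T (dual T)
edge-dual T = canonicalWord T , canonicalWord-isPermutation T , shape-bst-canonicalWord T , refl

size-dual : ∀ T → size (dual T) ≡ size T
size-dual T = edge-size (edge-sym (edge-dual T))

dual-node-leaf : ∀ B → dual (node leaf B) ≡ addRightmost (dual B)
dual-node-leaf B = begin
  shape (bst (inverse (map suc w ∷ʳ 0)))    ≡⟨ cong (shape ∘ bst) (inverse-rotate w-perm) ⟩
  shape (insert (size B) (bst (inverse w))) ≡⟨ insert-max (bst (inverse w)) (bst-AllLabels⁺ w⁻¹<n) ⟩
  addRightmost (dual B)                     ∎
  where
  open ≡-Reasoning
  w = canonicalWord B
  w-perm = canonicalWord-isPermutation B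
  w⁻¹<n = IsPermutation.bounded (inverse-isPermutation w-perm)

StartsAscending : List ℕ → Set
StartsAscending (x ∷ y ∷ _) = x < y
StartsAscending _           = ⊥

startsAscending? : Decidable StartsAscending
startsAscending? []          = no id
startsAscending? (_ ∷ [])    = no id
startsAscending? (x ∷ y ∷ _) = x <? y

startsAscending-rotate : ∀ w → StartsAscending w → StartsAscending (map suc w ∷ʳ 0)
startsAscending-rotate (x ∷ y ∷ _) x<y = s<s x<y

canonicalWord-node : ∀ a b → ∃[ x ] ∃[ xs ] canonicalWord (node a b) ≡ x ∷ xs
canonicalWord-node a b with merge (canonicalWord a) (map (suc (size a) +_) (canonicalWord b))
... | []     = size a , [] , refl
... | x ∷ xs = x , xs ∷ʳ size a , refl

startsAscending-node-node : ∀ a b c d → StartsAscending (canonicalWord (node (node a b) (node c d)))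
startsAscending-node-node a b c d with canonicalWord-node a b | canonicalWord-node c d
... | x , xs , eqA | z , zs , eqC rewrite eqA | eqC =
  <-≤-trans (IsPermutation.∈⇒< (canonicalWord-isPermutation (node a b)) (subst (x ∈_) (sym eqA) (here refl)))
            (≤-trans (n≤1+n _) (m≤m+n _ z))

data RightComb : BT → Set where
  leaf : RightComb leaf
  node : ∀ {r} → RightComb r → RightComb (node leaf r)

rightComb? : Decidable RightComb
rightComb? leaf                = yes leaf
rightComb? (node (node _ _) _) = no λ ()
rightComb? (node leaf r) with rightComb? r
... | yes comb = yes (node comb)
... | no ¬comb = no λ { (node comb) → ¬comb comb }

rightComb-rightBranch : ∀ {t} → RightComb t → rightBranch t ≡ size t
rightComb-rightBranch leaf        = refl
rightComb-rightBranch (node comb) = cong suc (rightComb-rightBranch comb)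

rightBranch≤size : ∀ t → rightBranch t ≤ size t
rightBranch≤size leaf       = z≤n
rightBranch≤size (node l r) = s≤s (≤-trans (rightBranch≤size r) (m≤n+m (size r) (size l)))

¬rightComb-rightBranch : ∀ t → ¬ RightComb t → rightBranch t < size t
¬rightComb-rightBranch leaf                ¬comb = contradiction leaf ¬comb
¬rightComb-rightBranch (node leaf r)       ¬comb = s<s (¬rightComb-rightBranch r (¬comb ∘ node))
¬rightComb-rightBranch (node (node a b) r) _     = s<s (s≤s (≤-trans (rightBranch≤size r) (m≤n+m (size r) _)))

rightComb-unique : ∀ {t u} → RightComb t → RightComb u → size t ≡ size u → t ≡ u
rightComb-unique leaf      leaf      _     = refl
rightComb-unique (node ct) (node cu) size≡ = cong (node leaf) (rightComb-unique ct cu (suc-injective size≡))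

rightComb-sameSkeleton : ∀ {t u} → size t ≡ size u → skeleton t ≡ (0 , rightBranch t) → skeleton u ≡ (0 , rightBranch u) →
                         skeleton t ≡ skeleton u → RightComb t → RightComb u
rightComb-sameSkeleton {t} {u} size≡ skel-t skel-u skel≡ comb with rightComb? u
... | yes combU = combU
... | no ¬combU = contradiction (begin
  rightBranch u ≡⟨ cong proj₂ (trans (sym skel-u) (trans (sym skel≡) skel-t)) ⟩
  rightBranch t ≡⟨ rightComb-rightBranch comb ⟩
  size t        ≡⟨ size≡ ⟩
  size u        ∎) (<⇒≢ (¬rightComb-rightBranch u ¬combU))
  where open ≡-Reasoning

rightComb-addRightmost⁻ : ∀ {t} → RightComb (addRightmost t) → RightComb t
rightComb-addRightmost⁻ {leaf}        _           = leaf
rightComb-addRightmost⁻ {node leaf r} (node comb) = node (rightComb-addRightmost⁻ comb)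

rightComb-insert⁻ : ∀ {x} t → RightComb (shape (insert x t)) → AllLabels (_< x) t
rightComb-insert⁻ lleaf _ = lleaf
rightComb-insert⁻ {x} (lnode l y r) comb with y <ᵇ x | <ᵇ-reflects-< y x | comb
rightComb-insert⁻ (lnode lleaf y r) _ | true | ofʸ y<x | node comb = lnode lleaf y<x (rightComb-insert⁻ r comb)
rightComb-insert⁻ {x} (lnode l y r) _ | false | _ | comb′ with shape-insert x l
... | a , b , eq = contradiction (subst (λ s → RightComb (node s (shape r))) eq comb′) λ ()

rightComb-bst-head : ∀ {m x w} → IsPermutation (suc m) (x ∷ w) → RightComb (shape (bst (x ∷ w))) → x ≡ m
rightComb-bst-head {m} {x} {w} xw-perm comb with IsPermutation.<⇒∈ xw-perm (n<1+n m)
... | here m≡x  = sym m≡x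
... | there m∈w = contradiction (All.lookup (bst-AllLabels⁻ w (rightComb-insert⁻ (bst w) comb)) m∈w)
                                (≤⇒≯ (s≤s⁻¹ (IsPermutation.∈⇒< xw-perm (here refl))))

rightComb-bst-inverse⇒last≡0 : ∀ {m σ} → IsPermutation (suc m) σ → RightComb (shape (bst (inverse σ))) → nth σ m ≡ 0
rightComb-bst-inverse⇒last≡0 {m} {σ} σ-perm comb = begin
  nth σ m           ≡⟨ cong (nth σ) (rightComb-bst-head (subst (IsPermutation (suc m)) π≡ (inverse-isPermutation σ-perm))
                                                        (subst (RightComb ∘ shape ∘ bst) π≡ comb)) ⟨
  nth σ (index 0 σ) ≡⟨ nth-index σ (<⇒∈ z<s) ⟩
  0                 ∎
  where
  open ≡-Reasoning
  open IsPermutation σ-perm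
  π≡ : inverse σ ≡ index 0 σ ∷ applyUpTo (λ j → index (suc j) σ) m
  π≡ = trans (inverse-applyUpTo σ) (cong (applyUpTo (λ j → index j σ)) length≡)

¬rightComb-dual-node-node : ∀ a b B → ¬ RightComb (dual (node (node a b) B))
¬rightComb-dual-node-node a b B comb = contradiction
  (trans (sym (nth-last prefix (size A) length-prefix)) (rightComb-bst-inverse⇒last≡0 (canonicalWord-isPermutation X) comb))
  λ ()
  where
  A = node a b
  X = node A B
  prefix = merge (canonicalWord A) (map (suc (size A) +_) (canonicalWord B))
  length-prefix : length prefix ≡ size A + size B
  length-prefix =
    suc-injective (trans (sym (length-∷ʳ prefix (size A))) (IsPermutation.length≡ (canonicalWord-isPermutation X)))

rightComb-dual⁻ : ∀ t → RightComb (dual t) → RightComb t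
rightComb-dual⁻ leaf                _    = leaf
rightComb-dual⁻ (node leaf B)       comb =
  node (rightComb-dual⁻ B (rightComb-addRightmost⁻ (subst RightComb (dual-node-leaf B) comb)))
rightComb-dual⁻ (node (node a b) B) comb = contradiction comb (¬rightComb-dual-node-node a b B)

¬ascending-addRightmost⇒rightComb : ∀ t → ¬ StartsAscending (canonicalWord (addRightmost t)) → RightComb t
¬ascending-addRightmost⇒rightComb leaf                         _    = leaf
¬ascending-addRightmost⇒rightComb (node leaf r)                ¬asc =
  node (¬ascending-addRightmost⇒rightComb r (¬asc ∘ startsAscending-rotate (canonicalWord (addRightmost r))))
¬ascending-addRightmost⇒rightComb (node (node a b) leaf)       ¬asc =
  contradiction (startsAscending-node-node a b leaf leaf) ¬asc
¬ascending-addRightmost⇒rightComb (node (node a b) (node c d)) ¬asc =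
  contradiction (startsAscending-node-node a b c (addRightmost d)) ¬asc

¬ascending-dual⇒rightComb : ∀ B → ¬ StartsAscending (canonicalWord (dual (node leaf B))) → RightComb (node leaf B)
¬ascending-dual⇒rightComb B ¬asc = node (rightComb-dual⁻ B (¬ascending-addRightmost⇒rightComb (dual B)
  (¬asc ∘ subst (StartsAscending ∘ canonicalWord) (sym (dual-node-leaf B)))))

data LeftmostLabel (k : ℕ) : LT → Set where
  leftmost : ∀ {r} → LeftmostLabel k (lnode lleaf k r)
  descend  : ∀ {l y r} → LeftmostLabel k l → LeftmostLabel k (lnode l y r)

data LeftmostCherry : LT → Set where
  cherry  : ∀ {r} → LeftmostCherry (lnode (lnode lleaf 0 lleaf) 1 r)
  descend : ∀ {l y r} → LeftmostCherry l → LeftmostCherry (lnode l y r)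

insert-LeftmostLabel : ∀ {k x t} → k < x → LeftmostLabel k t → LeftmostLabel k (insert x t)
insert-LeftmostLabel {k} {x} k<x leftmost with k <ᵇ x | <ᵇ-reflects-< k x
... | true  | _       = leftmost
... | false | ofⁿ k≮x = contradiction k<x k≮x
insert-LeftmostLabel {x = x} k<x (descend {y = y} lm) with y <ᵇ x
... | true  = descend lm
... | false = descend (insert-LeftmostLabel k<x lm)

insert-min-LeftmostLabel : ∀ {x} t → AllLabels (x ≤_) t → LeftmostLabel x (insert x t)
insert-min-LeftmostLabel lleaf _ = leftmost
insert-min-LeftmostLabel {x} (lnode l y r) (lnode x≤l x≤y _) with y <ᵇ x | <ᵇ-reflects-< y x
... | true  | ofʸ y<x = contradiction x≤y (<⇒≱ y<x)
... | false | _       = descend (insert-min-LeftmostLabel l x≤l)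

insert-0-LeftmostCherry : ∀ {t} → LeftmostLabel 1 t → LeftmostCherry (insert 0 t)
insert-0-LeftmostCherry leftmost     = cherry
insert-0-LeftmostCherry (descend lm) = descend (insert-0-LeftmostCherry lm)

insert-LeftmostCherry : ∀ {x t} → 1 < x → LeftmostCherry t → LeftmostCherry (insert x t)
insert-LeftmostCherry {x} 1<x cherry with 1 <ᵇ x | <ᵇ-reflects-< 1 x
... | true  | _       = cherry
... | false | ofⁿ 1≮x = contradiction 1<x 1≮x
insert-LeftmostCherry {x} 1<x (descend {y = y} c) with y <ᵇ x
... | true  = descend c
... | false = descend (insert-LeftmostCherry 1<x c)

leftmostCherry-shape : ∀ {t} → LeftmostCherry t → ∃[ t₀ ] shape t ≡ addLeftmost t₀
leftmostCherry-shape (cherry {r}) = node leaf (shape r) , refl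
leftmostCherry-shape (descend {r = r} c) with leftmostCherry-shape c
... | t₀ , eq = node t₀ (shape r) , cong (λ s → node s (shape r)) eq

bst-LeftmostCherry : ∀ α γ δ → All (1 <_) α → All (1 <_) γ → All (1 <_) δ → LeftmostCherry (bst (α ++ 0 ∷ γ ++ 1 ∷ δ))
bst-LeftmostCherry α γ δ α>1 γ>1 δ>1 =
  subst LeftmostCherry (sym bst≡)
    (insertAll-preserves {LeftmostCherry} insert-LeftmostCherry α>1
      (insert-0-LeftmostCherry (insertAll-preserves {LeftmostLabel 1} insert-LeftmostLabel γ>1
        (insert-min-LeftmostLabel (bst δ) (bst-AllLabels⁺ (All.map <⇒≤ δ>1))))))
  where
  bst≡ : bst (α ++ 0 ∷ γ ++ 1 ∷ δ) ≡ foldr insert (insert 0 (foldr insert (insert 1 (bst δ)) γ)) α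
  bst≡ = trans (foldr-++ insert lleaf α _) (cong (λ t → foldr insert (insert 0 t) α) (foldr-++ insert lleaf γ _))

∉01⇒>1 : ∀ {xs} → 0 ∉ xs → 1 ∉ xs → All (1 <_) xs
∉01⇒>1 {xs} 0∉ 1∉ = All.tabulate >1
  where
  >1 : ∀ {z} → z ∈ xs → 1 < z
  >1 {zero}        z∈ = contradiction z∈ 0∉
  >1 {suc zero}    z∈ = contradiction z∈ 1∉
  >1 {suc (suc _)} _  = s<s z<s

1∈-after-0 : ∀ α {β} → Unique (α ++ 0 ∷ β) → 1 ∈ α ++ 0 ∷ β →
             index 0 (α ++ 0 ∷ β) < index 1 (α ++ 0 ∷ β) → 1 ∈ β
1∈-after-0 α {β} uniq 1∈π 0before1 with ∈-++⁻ α 1∈π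
... | inj₂ (there 1∈β) = 1∈β
... | inj₁ 1∈α = contradiction 0before1 (≤⇒≯ (begin
  index 1 (α ++ 0 ∷ β)       ≡⟨ index-++ˡ α _ 1∈α ⟩
  index 1 α                  ≤⟨ <⇒≤ (index-< α 1∈α) ⟩
  length α                   ≤⟨ m≤m+n (length α) 0 ⟩
  length α + index 0 (0 ∷ β) ≡⟨ index-++ʳ α _ (proj₁ (unique-middle α uniq)) ⟨
  index 0 (α ++ 0 ∷ β)       ∎))
  where open ≤-Reasoning

0-before-1⇒bst-LeftmostCherry : ∀ {π} → Unique π → 0 ∈ π → 1 ∈ π → index 0 π < index 1 π → LeftmostCherry (bst π)
0-before-1⇒bst-LeftmostCherry uniq 0∈π 1∈π 0before1 with ∈-∃++ 0∈π
... | α , β , refl with ∈-∃++ (1∈-after-0 α uniq 1∈π 0before1)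
...   | γ , δ , refl = bst-LeftmostCherry α γ δ
  (∉01⇒>1 0∉α (1∉α0γ ∘ ∈-++⁺ˡ))
  (∉01⇒>1 (0∉β ∘ ∈-++⁺ˡ) (1∉α0γ ∘ ∈-++⁺ʳ α ∘ there))
  (∉01⇒>1 (0∉β ∘ ∈-++⁺ʳ γ ∘ there) 1∉δ)
  where
  0∉α = proj₁ (unique-middle α uniq)
  0∉β = proj₂ (unique-middle α uniq)
  1∉  = unique-middle (α ++ 0 ∷ γ) (subst Unique (sym (++-assoc α (0 ∷ γ) (1 ∷ δ))) uniq)
  1∉α0γ = proj₁ 1∉
  1∉δ   = proj₂ 1∉

ascending⇒bst-inverse-LeftmostCherry : ∀ {n σ} → IsPermutation n σ → StartsAscending σ → LeftmostCherry (bst (inverse σ))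
ascending⇒bst-inverse-LeftmostCherry {n} {x ∷ y ∷ _} σ-perm x<y =
  0-before-1⇒bst-LeftmostCherry π.unique (π.<⇒∈ 0<n) (π.<⇒∈ 1<n)
    (subst₂ _<_ (sym (index-inverse σ-perm 0<n)) (sym (index-inverse σ-perm 1<n)) x<y)
  where
  module π = IsPermutation (inverse-isPermutation σ-perm)
  1<n : 1 < n
  1<n = subst (1 <_) (IsPermutation.length≡ σ-perm) (s<s z<s)
  0<n = <-trans z<s 1<n

-- Trees with the same skeleton are connected

edge-∷ʳ-max : ∀ {m S U} → Edge m S U → Edge (suc m) (node S leaf) (node U leaf)
edge-∷ʳ-max {m} (σ , σ-perm , refl , refl) =
  σ ∷ʳ m , ∷ʳ-max-isPermutation σ-perm , shape-bst-∷ʳ-max σ (IsPermutation.bounded σ-perm) ,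
  trans (cong (shape ∘ bst) (inverse-∷ʳ-max σ-perm))
        (shape-bst-∷ʳ-max (inverse σ) (IsPermutation.bounded (inverse-isPermutation σ-perm)))

shape-bst-prepend-min : ∀ σ → shape (bst (0 ∷ map suc σ)) ≡ addLeftmost (shape (bst σ))
shape-bst-prepend-min σ =
  trans (insert-min (bst (map suc σ)) (bst-AllLabels⁺ {w = map suc σ} (All.universal (λ _ → z≤n) _)))
        (cong addLeftmost (shape-bst-map s<s σ))

edge-prepend-min : ∀ {m S U} → Edge m S U → Edge (suc m) (addLeftmost S) (addLeftmost U)
edge-prepend-min (σ , σ-perm , refl , refl) =
  0 ∷ map suc σ , prepend-min-isPermutation σ-perm , shape-bst-prepend-min σ ,
  trans (cong (shape ∘ bst) (inverse-prepend-min σ)) (shape-bst-prepend-min (inverse σ))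

star-∷ʳ-max : ∀ {m S U} → Star (Edge m) S U → Star (Edge (suc m)) (node S leaf) (node U leaf)
star-∷ʳ-max = Star.gmap (λ t → node t leaf) edge-∷ʳ-max

star-prepend-min : ∀ {m S U} → Star (Edge m) S U → Star (Edge (suc m)) (addLeftmost S) (addLeftmost U)
star-prepend-min = Star.gmap addLeftmost edge-prepend-min

ascending⇒edge-addLeftmost : ∀ t → StartsAscending (canonicalWord t) → ∃[ t₀ ] Edge (size t) t (addLeftmost t₀)
ascending⇒edge-addLeftmost t asc =
  let t₀ , eq = leftmostCherry-shape (ascending⇒bst-inverse-LeftmostCherry (canonicalWord-isPermutation t) asc)
  in t₀ , subst (Edge (size t) t) eq (edge-dual t)

reach-addLeftmost : ∀ A c d → ¬ RightComb (node A (node c d)) →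
                    ∃[ t₀ ] Star (Edge (size (node A (node c d)))) (node A (node c d)) (addLeftmost t₀)
reach-addLeftmost (node a b) c d _ = map₂ Star.return (ascending⇒edge-addLeftmost _ (startsAscending-node-node a b c d))
reach-addLeftmost leaf       c d ¬comb with startsAscending? (canonicalWord (dual (node leaf (node c d))))
... | yes asc = let t₀ , e = ascending⇒edge-addLeftmost (dual t) asc
                in t₀ , edge-dual t ◅ subst (λ k → Edge k (dual t) (addLeftmost t₀)) (size-dual t) e ◅ ε
  where t = node leaf (node c d)
... | no ¬asc = contradiction (¬ascending-dual⇒rightComb (node c d) ¬asc) ¬comb

reach-addLeftmost-sameSkeleton :
  ∀ {m} l c d → let t = node l (node c d) in size t ≡ suc (suc m) → ¬ RightComb t →
  ∃[ t₀ ] (Star (Edge (suc (suc m))) t (addLeftmost t₀) × size t₀ ≡ suc m × skeleton t₀ ≡ skeleton t)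
reach-addLeftmost-sameSkeleton {m} l c d size≡ ¬comb =
  let t₀ , path = reach-addLeftmost l c d ¬comb
      size-t₀   = suc-injective (trans (sym (size-addLeftmost t₀)) (trans (sym (star-size path)) size≡))
      skel≡     = star-skeleton path
      k≡0       = trans (cong proj₁ (sym skel≡)) (cong proj₁ (skeleton-node-node l c d))
  in t₀ , subst (λ k → Star (Edge k) (node l (node c d)) (addLeftmost t₀)) size≡ path , size-t₀ ,
     trans (sym (skeleton-addLeftmost t₀ (subst (0 <_) (sym size-t₀) z<s) k≡0)) (sym skel≡)

rightChild-sameSkeleton⇒star :
  ∀ {m} → (∀ {S U} → size S ≡ suc m → size U ≡ suc m → skeleton S ≡ skeleton U → Star (Edge (suc m)) S U) →
  ∀ l a b l′ c d → let S = node l (node a b) ; U = node l′ (node c d) in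
  size S ≡ suc (suc m) → size U ≡ suc (suc m) → skeleton S ≡ skeleton U → Star (Edge (suc (suc m))) S U
rightChild-sameSkeleton⇒star IH l a b l′ c d sS sU skel≡ with rightComb? (node l (node a b))
... | yes combS = subst (Star _ _) (rightComb-unique combS (S⇒U combS) (trans sS (sym sU))) ε
  where S⇒U = rightComb-sameSkeleton (trans sS (sym sU)) (skeleton-node-node l a b) (skeleton-node-node l′ c d) skel≡
... | no ¬combS =
  let s₀ , S⇝ , size-s₀ , skel-s₀ = reach-addLeftmost-sameSkeleton l a b sS ¬combS
      u₀ , U⇝ , size-u₀ , skel-u₀ = reach-addLeftmost-sameSkeleton l′ c d sU (¬combS ∘ U⇒S)
  in S⇝ ◅◅ star-prepend-min (IH size-s₀ size-u₀ (trans skel-s₀ (trans skel≡ (sym skel-u₀)))) ◅◅ star-sym U⇝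
  where U⇒S = rightComb-sameSkeleton (trans sU (sym sS)) (skeleton-node-node l′ c d) (skeleton-node-node l a b) (sym skel≡)

size≡0 : ∀ {t} → size t ≡ 0 → t ≡ leaf
size≡0 {leaf} _ = refl

size≡1 : ∀ {t} → size t ≡ 1 → t ≡ node leaf leaf
size≡1 {node leaf leaf} _ = refl

sameSkeleton⇒star : ∀ n {S U} → size S ≡ n → size U ≡ n → skeleton S ≡ skeleton U → Star (Edge n) S U
sameSkeleton⇒star zero       sS sU _ = subst (Star (Edge 0) _) (trans (size≡0 sS) (sym (size≡0 sU))) ε
sameSkeleton⇒star (suc zero) sS sU _ = subst (Star (Edge 1) _) (trans (size≡1 sS) (sym (size≡1 sU))) ε
sameSkeleton⇒star (suc (suc m)) {node (node a b) leaf} {node (node c d) leaf} sS sU skel≡ =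
  star-∷ʳ-max (sameSkeleton⇒star (suc m) (leftSize (node a b) sS) (leftSize (node c d) sU)
    (cong₂ _,_ (suc-injective (cong proj₁ skel≡′)) (cong proj₂ skel≡′)))
  where
  leftSize : ∀ t → size (node t leaf) ≡ suc (suc m) → size t ≡ suc m
  leftSize t eq = trans (sym (+-identityʳ (size t))) (suc-injective eq)
  skel≡′ = trans (sym (skeleton-node-leaf a b)) (trans skel≡ (skeleton-node-leaf c d))
sameSkeleton⇒star (suc (suc m)) {node (node a b) leaf} {node l (node c d)} _ _ skel≡ =
  contradiction (trans (cong proj₁ skel≡) (cong proj₁ (skeleton-node-node l c d))) (skeleton-node-leaf≢0 a b)
sameSkeleton⇒star (suc (suc m)) {node l (node a b)} {node (node c d) leaf} _ _ skel≡ =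
  contradiction (trans (cong proj₁ (sym skel≡)) (cong proj₁ (skeleton-node-node l a b))) (skeleton-node-leaf≢0 c d)
sameSkeleton⇒star (suc (suc m)) {node l (node a b)} {node l′ (node c d)} =
  rightChild-sameSkeleton⇒star (sameSkeleton⇒star (suc m)) l a b l′ c d
sameSkeleton⇒star (suc (suc m)) {leaf}               ()
sameSkeleton⇒star (suc (suc m)) {node leaf leaf}     ()
sameSkeleton⇒star (suc (suc m)) {_} {leaf}           _ ()
sameSkeleton⇒star (suc (suc m)) {_} {node leaf leaf} _ ()

mainTheorem18 : (n : ℕ) → n ≥ 1 → (T U : BT) → size T ≡ n → size U ≡ n →
    SameBlock n T U ⇔ (size T ≡ size U × skeleton T ≡ skeleton U)
mainTheorem18 n _ T U sT sU = mk⇔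
  (λ (k , Mpow≢0) → trans sT (sym sU) , star-skeleton (Mpow≢0⇒star n k T U Mpow≢0))
  (λ (_ , skel≡) → star⇒Mpow≢0 (sameSkeleton⇒star n sT sU skel≡))
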